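{- If a biased graph $\Omega$ contains a contrabalanced theta with a shortcut, then $F(\Omega)$ has a $U_{2,4}$ minor.
   Context: A biased graph $\Omega=(G,\mathcal B)$: a graph $G$ with a collection $\mathcal B$ of cycles, called balanced, such that no theta subgraph contains exactly two balanced cycles. $F(\Omega)$ is the frame matroid on $E(G)$ whose circuits are the edge sets of balanced cycles, of two unbalanced cycles sharing exactly one vertex and no edge, of two vertex-disjoint unbalanced cycles joined by a path meeting each only at an endpoint, and of theta subgraphs with all three cycles unbalanced. A contrabalanced theta is a theta subgraph $T$, formed by three internally disjoint $x$-$y$ paths $Q_1,Q_2,Q_3$, all of whose three cycles are unbalanced; $x,y$ are its branch vertices. A shortcut of $T$ is a path linking two of $Q_1,Q_2,Q_3$, otherwise avoiding $T$ (in particular avoiding the third path), neither of whose endpoints is a branch vertex. -}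

module Defs where

open import Data.Nat using (ℕ; zero; suc; _+_; _≤_)
open import Data.Bool using (Bool; true; false; _∧_)
open import Data.Fin using (Fin; zero; suc; inject₁; fromℕ)
open import Data.Fin.Properties using (any?; _≟_)
open import Data.Fin.Subset using (Subset; _∈_; _∉_; _⊆_; _∪_; ⁅_⁆; ∣_∣)
open import Data.Fin.Subset.Properties using (_∈?_)
open import Data.Vec using (tabulate)
open import Data.Product using (Σ; ∃; _×_; _,_)
open import Data.Sum using (_⊎_)
open import Relation.Nullary using (¬_; does)
open import Relation.Binary.PropositionalEquality using (_≡_; _≢_)
open import Function using (Injective; _⇔_)

-- Finite graphs (multigraphs, loops allowed): vertices Fin n, edges Fin m,
-- each edge has an (unordered) pair of ends.

record Graph (n m : ℕ) : Set where
  field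
    ends : Fin m → Fin n × Fin n

open Graph public

Joins : ∀ {n m} → Graph n m → Fin m → Fin n → Fin n → Set
Joins G e u v = (ends G e ≡ (u , v)) ⊎ (ends G e ≡ (v , u))

image : ∀ {k m} → (Fin k → Fin m) → Subset m
image f = tabulate (λ e → does (any? (λ i → f i ≟ e)))

-- Cycles: vertices v₀ … v_len (distinct), edges e₀ … e_len (distinct),
-- e_i joins v_i and v_{i+1}, and e_len joins v_len and v₀.
-- (len = 0 : a loop; len = 1 : two parallel edges.)

record Cycle {n m : ℕ} (G : Graph n m) : Set where
  field
    len     : ℕ
    vtx     : Fin (suc len) → Fin n
    edg     : Fin (suc len) → Fin m
    vtx-inj : Injective _≡_ _≡_ vtx
    edg-inj : Injective _≡_ _≡_ edg
    link    : (i : Fin len) → Joins G (edg (inject₁ i)) (vtx (inject₁ i)) (vtx (suc i))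
    close   : Joins G (edg (fromℕ len)) (vtx (fromℕ len)) (vtx zero)

  edges : Subset m
  edges = image edg

  OnCycle : Fin n → Set
  OnCycle v = ∃ λ i → vtx i ≡ v

open Cycle public using (OnCycle)

cycleEdges : ∀ {n m} {G : Graph n m} → Cycle G → Subset m
cycleEdges C = Cycle.edges C

-- Paths with at least one edge: distinct vertices v₀ … v_{len+1},
-- distinct edges e₀ … e_len, e_i joins v_i and v_{i+1}.

record Path {n m : ℕ} (G : Graph n m) : Set where
  field
    len     : ℕ
    vtx     : Fin (suc (suc len)) → Fin n
    edg     : Fin (suc len) → Fin m
    vtx-inj : Injective _≡_ _≡_ vtx
    edg-inj : Injective _≡_ _≡_ edg
    link    : (i : Fin (suc len)) → Joins G (edg i) (vtx (inject₁ i)) (vtx (suc i))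

  start : Fin n
  start = vtx zero

  end : Fin n
  end = vtx (fromℕ (suc len))

  edges : Subset m
  edges = image edg

  OnPath : Fin n → Set
  OnPath v = ∃ λ i → vtx i ≡ v

  Internal : Fin n → Set
  Internal v = OnPath v × v ≢ start × v ≢ end

pathEdges : ∀ {n m} {G : Graph n m} → Path G → Subset m
pathEdges P = Path.edges P

record Theta {n m : ℕ} (G : Graph n m) : Set where
  field
    x y       : Fin n
    x≢y       : x ≢ y
    Q         : Fin 3 → Path G
    Q-start   : ∀ i → Path.start (Q i) ≡ x
    Q-end     : ∀ i → Path.end (Q i) ≡ y
    int-disj  : ∀ i j → i ≢ j → ∀ v → Path.Internal (Q i) v → ¬ Path.Internal (Q j) v
    edge-disj : ∀ i j → i ≢ j → ∀ e → e ∈ pathEdges (Q i) → e ∉ pathEdges (Q j)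

  cyc : Fin 3 → Fin 3 → Subset m
  cyc i j = pathEdges (Q i) ∪ pathEdges (Q j)

  edges : Subset m
  edges = pathEdges (Q zero) ∪ (pathEdges (Q (suc zero)) ∪ pathEdges (Q (suc (suc zero))))

  OnTheta : Fin n → Set
  OnTheta v = ∃ λ i → Path.OnPath (Q i) v

count3 : Bool → Bool → Bool → ℕ
count3 a b c = b2n a + (b2n b + b2n c)
  where
  b2n : Bool → ℕ
  b2n true  = 1
  b2n false = 0

record BiasedGraph (n m : ℕ) : Set where
  field
    graph        : Graph n m
    balanced     : Subset m → Bool
    balanced-cyc : ∀ S → balanced S ≡ true → Σ (Cycle graph) λ C → cycleEdges C ≡ S
    theta-prop   : (T : Theta graph) →
                   count3 (balanced (Theta.cyc T zero (suc zero)))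
                          (balanced (Theta.cyc T zero (suc (suc zero))))
                          (balanced (Theta.cyc T (suc zero) (suc (suc zero)))) ≢ 2

open BiasedGraph public

module _ {n m : ℕ} (Ω : BiasedGraph n m) where

  private G = graph Ω

  UnbalancedCycle : Cycle G → Set
  UnbalancedCycle C = balanced Ω (cycleEdges C) ≡ false

  Contrabalanced : Theta G → Set
  Contrabalanced T = ∀ i j → i ≢ j → balanced Ω (Theta.cyc T i j) ≡ false

  Shortcut : Theta G → Path G → Set
  Shortcut T P =
    (Σ (Fin 3) λ i → Σ (Fin 3) λ j → i ≢ j ×
       Path.Internal (Theta.Q T i) (Path.start P) ×
       Path.Internal (Theta.Q T j) (Path.end P)) ×
    (∀ v → Path.Internal P v → ¬ Theta.OnTheta T v) ×
    (∀ e → e ∈ pathEdges P → e ∉ Theta.edges T)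

  data FrameCircuit : Subset m → Set where
    balanced-cycle : (C : Cycle G) → balanced Ω (cycleEdges C) ≡ true →
                     FrameCircuit (cycleEdges C)
    tight-handcuff : (C₁ C₂ : Cycle G) → UnbalancedCycle C₁ → UnbalancedCycle C₂ →
                     (∀ e → e ∈ cycleEdges C₁ → e ∉ cycleEdges C₂) →
                     (v : Fin n) → OnCycle C₁ v → OnCycle C₂ v →
                     (∀ w → OnCycle C₁ w → OnCycle C₂ w → w ≡ v) →
                     FrameCircuit (cycleEdges C₁ ∪ cycleEdges C₂)
    loose-handcuff : (C₁ C₂ : Cycle G) → UnbalancedCycle C₁ → UnbalancedCycle C₂ →
                     (∀ w → OnCycle C₁ w → ¬ OnCycle C₂ w) →
                     (P : Path G) →
                     OnCycle C₁ (Path.start P) → OnCycle C₂ (Path.end P) →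
                     (∀ w → Path.OnPath P w → OnCycle C₁ w → w ≡ Path.start P) →
                     (∀ w → Path.OnPath P w → OnCycle C₂ w → w ≡ Path.end P) →
                     FrameCircuit (cycleEdges C₁ ∪ (cycleEdges C₂ ∪ pathEdges P))
    contra-theta   : (T : Theta G) → Contrabalanced T → FrameCircuit (Theta.edges T)

  FrameIndep : Subset m → Set
  FrameIndep I = ∀ S → FrameCircuit S → ¬ (S ⊆ I)

imageSub : ∀ {k m} → (Fin k → Fin m) → Subset k → Subset m
imageSub {k} f I = tabulate (λ e → does (any? (λ i → (i ∈? I) ×-dec (f i ≟ e))))
  where open import Relation.Nullary using (_×-dec_)

UniformIndep : (r k : ℕ) → Subset k → Set
UniformIndep r k I = ∣ I ∣ ≤ r

-- N (on ground set Fin k) is isomorphic to a minor M / X \ D of M (on Fin m):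
-- φ identifies the elements of N with elements of M outside X, B is a basis
-- of X in M, and I is independent in N iff φ(I) ∪ B is independent in M
-- (i.e. φ(I) is independent in M / X); all other elements are deleted.
IsMinorOf : ∀ {k m} → (Subset k → Set) → (Subset m → Set) → Set
IsMinorOf {k} {m} N M =
  Σ (Fin k → Fin m) λ φ → Injective _≡_ _≡_ φ ×
  Σ (Subset m) λ X → Σ (Subset m) λ B →
    (∀ i → φ i ∉ X) ×
    B ⊆ X × M B × (∀ e → e ∈ X → e ∉ B → ¬ M (⁅ e ⁆ ∪ B)) ×
    (∀ I → N I ⇔ M (imageSub φ I ∪ B))

module Submission where

-- T together with the shortcut P is a subdivision of K₄ with nodes x, y (the
-- branch vertices) and a, b (the ends of P).  A closed edge set of it (no vertex
-- of degree one) is a union of segments forming a leafless set of edges of K₄.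
-- Suppose the triangle a b y is unbalanced.  Keep one edge from each of the
-- segments x–a, x–b, a–b, x–y and contract the rest of T ∪ P.  Two kept edges
-- together with the contracted ones contain exactly one nonempty closed set, the
-- cycle of K₄ minus the other two kept segments; it is the triangle a b y or a
-- cycle of T, hence unbalanced, so the union is independent.  Three kept edges
-- complete K₄ minus an edge, a theta, which contains a circuit.  So the minor on
-- the kept edges is U₂,₄.  The case of an unbalanced triangle a b x is symmetric,
-- and the two triangles cannot both be balanced: with the unbalanced cycle
-- Q₀ ∪ Q₁ they form a theta.

open import Defs
open import Data.Bool using (Bool; true; false; not; _∧_; if_then_else_)
open import Data.Empty using (⊥; ⊥-elim)
open import Data.Fin using (Fin; zero; suc; toℕ; fromℕ; fromℕ<; inject₁)
open import Data.Fin.Properties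
  using (any?; all?; toℕ-injective; toℕ-fromℕ; toℕ-inject₁; toℕ≤pred[n]; toℕ-fromℕ<; fromℕ≢inject₁; inject₁-injective)
  renaming (_≟_ to _≟ᶠ_)
open import Data.Fin.Subset using (Subset; _∈_; _∉_; _⊆_; _∪_; ⁅_⁆; ∣_∣; Nonempty; ⊤)
open import Data.Fin.Subset.Properties
  using (_∈?_; x∈p∪q⁻; x∈p∪q⁺; p⊆p∪q; q⊆p∪q; ⊆-antisym; ∪-comm; anySubset?; nonempty?; ∈⊤; x∈⁅x⁆; x∈⁅y⁆⇒x≡y)
open import Data.Nat using (ℕ; zero; suc; _+_; _∸_; _≤_; _<_; z≤n; s≤s; _≤?_)
open import Data.Nat.Properties hiding (_≟_)
open import Data.Product using (Σ; ∃; _×_; _,_; proj₁; proj₂)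
open import Data.Product.Properties using (,-injectiveˡ; ,-injectiveʳ)
open import Data.Sum as Sum using (_⊎_; inj₁; inj₂; [_,_])
open import Data.Vec using (tabulate)
open import Data.Vec.Properties using (lookup∘tabulate; []=⇒lookup; lookup⇒[]=; ≡-dec)
open import Data.Maybe using (Maybe; just; nothing)
open import Data.Maybe.Properties using () renaming (≡-dec to ≡-dec-Maybe)
open import Data.Bool.Properties using () renaming (_≟_ to _≟ᵇ_)
open import Relation.Nullary using (¬_; Dec; yes; no; does)
open import Relation.Nullary.Decidable
  using (dec-true; dec-false; toWitness; _×-dec_; _⊎-dec_; _→-dec_; ¬?; decidable-stable)
open import Relation.Unary using (Decidable)
open import Relation.Binary.PropositionalEquality hiding ([_])
open import Function using (Injective; _∘_; _⇔_; mk⇔)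

does⇒ : ∀ {a} {A : Set a} (d : Dec A) → does d ≡ true → A
does⇒ (yes a) _ = a

∈-tabulate⁺ : ∀ {k} (f : Fin k → Bool) {i} → f i ≡ true → i ∈ tabulate f
∈-tabulate⁺ f {i} fi = lookup⇒[]= i (tabulate f) (trans (lookup∘tabulate f i) fi)

∈-tabulate⁻ : ∀ {k} (f : Fin k → Bool) {i} → i ∈ tabulate f → f i ≡ true
∈-tabulate⁻ f {i} h = trans (sym (lookup∘tabulate f i)) ([]=⇒lookup h)

∈-image⁺ : ∀ {k m} (f : Fin k → Fin m) i → f i ∈ image f
∈-image⁺ f i = ∈-tabulate⁺ _ (dec-true (any? λ j → f j ≟ᶠ f i) (i , refl))

∈-image⁻ : ∀ {k m} (f : Fin k → Fin m) {x} → x ∈ image f → ∃ λ i → f i ≡ x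
∈-image⁻ f h = does⇒ (any? _) (∈-tabulate⁻ _ h)

∈-imageSub⁺ : ∀ {k m} (f : Fin k → Fin m) {I i} → i ∈ I → f i ∈ imageSub f I
∈-imageSub⁺ f {I} {i} h = ∈-tabulate⁺ _ (dec-true (any? λ j → (j ∈? I) ×-dec (f j ≟ᶠ f i)) (i , h , refl))

∈-imageSub⁻ : ∀ {k m} (f : Fin k → Fin m) {I x} → x ∈ imageSub f I → ∃ λ i → i ∈ I × f i ≡ x
∈-imageSub⁻ f h = does⇒ (any? _) (∈-tabulate⁻ _ h)

fromℕ-or-inject₁ : ∀ {l} (i : Fin (suc l)) → i ≡ fromℕ l ⊎ ∃ λ j → i ≡ inject₁ j
fromℕ-or-inject₁ {zero} zero = inj₁ refl
fromℕ-or-inject₁ {suc l} zero = inj₂ (zero , refl)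
fromℕ-or-inject₁ {suc l} (suc i) with fromℕ-or-inject₁ i
... | inj₁ eq = inj₁ (cong suc eq)
... | inj₂ (j , eq) = inj₂ (suc j , cong suc eq)

-- t as an element of Fin (suc N), with junk value zero when t > N
clamp : (N t : ℕ) → Fin (suc N)
clamp N t with t ≤? N
... | yes t≤N = fromℕ< (s≤s t≤N)
... | no _    = zero

toℕ-clamp : ∀ {N t} → t ≤ N → toℕ (clamp N t) ≡ t
toℕ-clamp {N} {t} t≤N with t ≤? N
... | yes p = toℕ-fromℕ< (s≤s p)
... | no t≰N = ⊥-elim (t≰N t≤N)

clamp-toℕ : ∀ {N} (i : Fin (suc N)) → clamp N (toℕ i) ≡ i
clamp-toℕ i = toℕ-injective (toℕ-clamp (toℕ≤pred[n] i))

≤-or-beyond : ∀ t N → t ≤ N ⊎ ∃ λ k → t ≡ suc N + k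
≤-or-beyond t N with t ≤? N
... | yes t≤N = inj₁ t≤N
... | no t≰N = inj₂ (t ∸ suc N , sym (m+[n∸m]≡n (≰⇒> t≰N)))

module RawPaths {n m : ℕ} (G : Graph n m) where

  joins-sym : ∀ {e u w} → Joins G e u w → Joins G e w u
  joins-sym (inj₁ p) = inj₂ p
  joins-sym (inj₂ p) = inj₁ p

  joins-ends : ∀ {e u w p q} → Joins G e u w → Joins G e p q → (u ≡ p × w ≡ q) ⊎ (u ≡ q × w ≡ p)
  joins-ends (inj₁ a) (inj₁ b) = let c = trans (sym a) b in inj₁ (,-injectiveˡ c , ,-injectiveʳ c)
  joins-ends (inj₁ a) (inj₂ b) = let c = trans (sym a) b in inj₂ (,-injectiveˡ c , ,-injectiveʳ c)
  joins-ends (inj₂ a) (inj₁ b) = let c = trans (sym a) b in inj₂ (,-injectiveʳ c , ,-injectiveˡ c)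
  joins-ends (inj₂ a) (inj₂ b) = let c = trans (sym a) b in inj₁ (,-injectiveʳ c , ,-injectiveˡ c)

  joins-end : ∀ {e u w p q} → Joins G e u w → Joins G e p q → u ≡ p ⊎ u ≡ q
  joins-end j k with joins-ends j k
  ... | inj₁ (u≡p , _) = inj₁ u≡p
  ... | inj₂ (u≡q , _) = inj₂ u≡q

  -- Paths indexed by ℕ, so that sub-paths, reversals and concatenations need no
  -- Fin arithmetic: vertices v 0 … v (suc len), edges e 0 … e len.
  record RawPath : Set where
    field
      len   : ℕ
      v     : ℕ → Fin n
      e     : ℕ → Fin m
      v-inj : ∀ {s t} → s ≤ suc len → t ≤ suc len → v s ≡ v t → s ≡ t
      e-inj : ∀ {s t} → s ≤ len → t ≤ len → e s ≡ e t → s ≡ t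
      link  : ∀ {t} → t ≤ len → Joins G (e t) (v t) (v (suc t))

  open RawPath public

  ends-at : ∀ R {t u w} → t ≤ len R → Joins G (e R t) u w → u ≡ v R t ⊎ u ≡ v R (suc t)
  ends-at R p j = joins-end j (link R p)

  last : RawPath → Fin n
  last R = v R (suc (len R))

  InE : RawPath → Fin m → Set
  InE R x = ∃ λ t → t ≤ len R × e R t ≡ x

  OnR : RawPath → Fin n → Set
  OnR R u = ∃ λ t → t ≤ suc (len R) × v R t ≡ u

  toPath : RawPath → Path G
  toPath R = record
    { len     = len R
    ; vtx     = λ i → v R (toℕ i)
    ; edg     = λ i → e R (toℕ i)
    ; vtx-inj = λ {i} {j} eq → toℕ-injective (v-inj R (toℕ≤pred[n] i) (toℕ≤pred[n] j) eq)
    ; edg-inj = λ {i} {j} eq → toℕ-injective (e-inj R (toℕ≤pred[n] i) (toℕ≤pred[n] j) eq)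
    ; link    = λ i → subst (λ k → Joins G (e R (toℕ i)) (v R k) (v R (suc (toℕ i))))
                            (sym (toℕ-inject₁ i)) (link R (toℕ≤pred[n] i))
    }

  fromPath : Path G → RawPath
  fromPath Q = record
    { len   = Q.len
    ; v     = λ t → Q.vtx (clamp (suc Q.len) t)
    ; e     = λ t → Q.edg (clamp Q.len t)
    ; v-inj = λ p q eq → trans (sym (toℕ-clamp p)) (trans (cong toℕ (Q.vtx-inj eq)) (toℕ-clamp q))
    ; e-inj = λ p q eq → trans (sym (toℕ-clamp p)) (trans (cong toℕ (Q.edg-inj eq)) (toℕ-clamp q))
    ; link  = λ {t} p → subst₂ (Joins G (Q.edg (clamp Q.len t)))
        (cong Q.vtx (toℕ-injective (trans (toℕ-inject₁ (clamp Q.len t))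
          (trans (toℕ-clamp p) (sym (toℕ-clamp (≤-trans p (n≤1+n _))))))))
        (cong Q.vtx (toℕ-injective (trans (cong suc (toℕ-clamp p)) (sym (toℕ-clamp (s≤s p))))))
        (Q.link (clamp Q.len t))
    }
    where module Q = Path Q

  E : RawPath → Subset m
  E R = pathEdges (toPath R)

  E⁺ : ∀ R {x} → InE R x → x ∈ E R
  E⁺ R (t , t≤ , refl) =
    subst (_∈ E R) (cong (e R) (toℕ-clamp t≤)) (∈-image⁺ (λ i → e R (toℕ i)) (clamp (len R) t))

  E⁻ : ∀ R {x} → x ∈ E R → InE R x
  E⁻ R h with ∈-image⁻ {k = suc (len R)} (λ i → e R (toℕ i)) h
  ... | i , eq = toℕ i , toℕ≤pred[n] i , eq

  toPath-end : ∀ R → Path.end (toPath R) ≡ last R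
  toPath-end R = cong (v R) (toℕ-fromℕ (suc (len R)))

  toPath-On⁻ : ∀ R {u} → Path.OnPath (toPath R) u → OnR R u
  toPath-On⁻ R (i , eq) = toℕ i , toℕ≤pred[n] i , eq

  module _ (Q : Path G) where
    private module Q = Path Q

    fromPath-v : ∀ (i : Fin (suc (suc Q.len))) → v (fromPath Q) (toℕ i) ≡ Q.vtx i
    fromPath-v i = cong Q.vtx (clamp-toℕ i)

    fromPath-start : v (fromPath Q) 0 ≡ Q.start
    fromPath-start = fromPath-v zero

    fromPath-end : last (fromPath Q) ≡ Q.end
    fromPath-end = trans (cong (v (fromPath Q)) (sym (toℕ-fromℕ (suc Q.len)))) (fromPath-v (fromℕ (suc Q.len)))

    fromPath-E : E (fromPath Q) ≡ pathEdges Q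
    fromPath-E = ⊆-antisym
      (λ h → let (t , _ , eq) = E⁻ (fromPath Q) h in subst (_∈ pathEdges Q) eq (∈-image⁺ Q.edg (clamp Q.len t)))
      (λ h → let (i , eq) = ∈-image⁻ Q.edg h in
             E⁺ (fromPath Q) (toℕ i , toℕ≤pred[n] i , trans (cong Q.edg (clamp-toℕ i)) eq))

    fromPath-On⁺ : ∀ {u} → OnR (fromPath Q) u → Q.OnPath u
    fromPath-On⁺ (t , _ , eq) = clamp (suc Q.len) t , eq

  segment : (R : RawPath) (lo k : ℕ) → lo + k ≤ len R → RawPath
  segment R lo k p = record
    { len   = k
    ; v     = λ t → v R (lo + t)
    ; e     = λ t → e R (lo + t)
    ; v-inj = λ a b eq → +-cancelˡ-≡ lo _ _ (v-inj R (bound a) (bound b) eq)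
    ; e-inj = λ a b eq → +-cancelˡ-≡ lo _ _ (e-inj R (≤-trans (+-monoʳ-≤ lo a) p) (≤-trans (+-monoʳ-≤ lo b) p) eq)
    ; link  = λ {t} a → subst (λ z → Joins G (e R (lo + t)) (v R (lo + t)) (v R z))
                              (sym (+-suc lo t)) (link R (≤-trans (+-monoʳ-≤ lo a) p))
    }
    where
    bound : ∀ {s} → s ≤ suc k → lo + s ≤ suc (len R)
    bound a = ≤-trans (+-monoʳ-≤ lo a) (≤-trans (≤-reflexive (+-suc lo k)) (s≤s p))

  segmentE⁻ : ∀ R lo k p {x} → InE (segment R lo k p) x → ∃ λ t → lo ≤ t × t ≤ lo + k × e R t ≡ x
  segmentE⁻ R lo k p (t , t≤ , eq) = lo + t , m≤m+n lo t , +-monoʳ-≤ lo t≤ , eq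

  segmentE⁺ : ∀ R lo k p {x} → (∃ λ t → lo ≤ t × t ≤ lo + k × e R t ≡ x) → InE (segment R lo k p) x
  segmentE⁺ R lo k p (t , lo≤t , t≤ , eq) =
    t ∸ lo , +-cancelˡ-≤ lo _ _ (subst (_≤ lo + k) (sym (m+[n∸m]≡n lo≤t)) t≤) , trans (cong (e R) (m+[n∸m]≡n lo≤t)) eq

  reverse : RawPath → RawPath
  reverse R = record
    { len   = len R
    ; v     = λ t → v R (suc (len R) ∸ t)
    ; e     = λ t → e R (len R ∸ t)
    ; v-inj = λ {s} {t} a b eq → ∸-cancelˡ-≡ a b (v-inj R (m∸n≤m _ s) (m∸n≤m _ t) eq)
    ; e-inj = λ {s} {t} a b eq → ∸-cancelˡ-≡ a b (e-inj R (m∸n≤m _ s) (m∸n≤m _ t) eq)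
    ; link  = λ {t} a → subst (λ z → Joins G (e R (len R ∸ t)) (v R z) (v R (len R ∸ t)))
                              (sym (+-∸-assoc 1 a)) (joins-sym (link R (m∸n≤m _ t)))
    }

  reverseE⁻ : ∀ R {x} → InE (reverse R) x → InE R x
  reverseE⁻ R (t , _ , eq) = len R ∸ t , m∸n≤m _ t , eq

  reverseE⁺ : ∀ R {x} → InE R x → InE (reverse R) x
  reverseE⁺ R (t , t≤ , eq) = len R ∸ t , m∸n≤m _ t , trans (cong (e R) (m∸[m∸n]≡n t≤)) eq

  reverseOn⁻ : ∀ R {u} → OnR (reverse R) u → OnR R u
  reverseOn⁻ R (t , _ , eq) = suc (len R) ∸ t , m∸n≤m _ t , eq

  reverse-last : ∀ R → last (reverse R) ≡ v R 0
  reverse-last R = cong (v R) (n∸n≡0 (suc (len R)))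

  module Concat (R₁ R₂ : RawPath) (junction : last R₁ ≡ v R₂ 0)
                (v-disj : ∀ {s t} → s ≤ suc (len R₁) → t ≤ suc (len R₂) → v R₁ s ≡ v R₂ t → t ≡ 0)
                (e-disj : ∀ {s t} → s ≤ len R₁ → t ≤ len R₂ → e R₁ s ≢ e R₂ t) where
    private
      L₁ = len R₁
      L₂ = len R₂

      cv : ℕ → Fin n
      cv t with ≤-or-beyond t (suc L₁)
      ... | inj₁ _ = v R₁ t
      ... | inj₂ (k , _) = v R₂ (suc k)

      ce : ℕ → Fin m
      ce t with ≤-or-beyond t L₁
      ... | inj₁ _ = e R₁ t
      ... | inj₂ (k , _) = e R₂ k

      cv-lo : ∀ {t} → t ≤ suc L₁ → cv t ≡ v R₁ t
      cv-lo {t} p with ≤-or-beyond t (suc L₁)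
      ... | inj₁ _ = refl
      ... | inj₂ (k , refl) = ⊥-elim (<⇒≱ (s≤s (m≤m+n (suc L₁) k)) p)

      cv-hi : ∀ k → cv (suc L₁ + k) ≡ v R₂ k
      cv-hi k with ≤-or-beyond (suc L₁ + k) (suc L₁)
      ... | inj₂ (j , eq) = cong (v R₂) (sym (+-cancelˡ-≡ (suc L₁) _ _ (trans eq (sym (+-suc (suc L₁) j)))))
      ... | inj₁ p rewrite n≤0⇒n≡0 (+-cancelˡ-≤ (suc L₁) k 0 (≤-trans p (≤-reflexive (sym (+-identityʳ _))))) =
        trans (cong (v R₁) (+-identityʳ (suc L₁))) junction

      cv-hi′ : ∀ j → cv (suc (suc L₁ + j)) ≡ v R₂ (suc j)
      cv-hi′ j = trans (cong cv (sym (+-suc (suc L₁) j))) (cv-hi (suc j))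

      ce-lo : ∀ {t} → t ≤ L₁ → ce t ≡ e R₁ t
      ce-lo {t} p with ≤-or-beyond t L₁
      ... | inj₁ _ = refl
      ... | inj₂ (k , refl) = ⊥-elim (<⇒≱ (s≤s (m≤m+n L₁ k)) p)

      ce-hi : ∀ k → ce (suc L₁ + k) ≡ e R₂ k
      ce-hi k with ≤-or-beyond (suc L₁ + k) L₁
      ... | inj₁ p = ⊥-elim (<⇒≱ (s≤s (m≤m+n L₁ k)) p)
      ... | inj₂ (j , eq) = cong (e R₂) (sym (+-cancelˡ-≡ (suc L₁) _ _ eq))

      split : ∀ {t} N M → t ≤ N + suc M → t ≤ N ⊎ ∃ λ j → t ≡ suc N + j × j ≤ M
      split {t} N M p with ≤-or-beyond t N
      ... | inj₁ q = inj₁ q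
      ... | inj₂ (j , refl) = inj₂ (j , refl , +-cancelˡ-≤ (suc N) _ _ (≤-trans p (≤-reflexive (+-suc N M))))

      cv-inj : ∀ {s t} → s ≤ suc (L₁ + suc L₂) → t ≤ suc (L₁ + suc L₂) → cv s ≡ cv t → s ≡ t
      cv-inj a b eq with split (suc L₁) L₂ a | split (suc L₁) L₂ b
      ... | inj₁ p | inj₁ q = v-inj R₁ p q (trans (sym (cv-lo p)) (trans eq (cv-lo q)))
      ... | inj₁ p | inj₂ (j , refl , q) with v-disj p (s≤s q) (trans (sym (cv-lo p)) (trans eq (cv-hi′ j)))
      ...   | ()
      cv-inj a b eq | inj₂ (j , refl , q) | inj₁ p with v-disj p (s≤s q) (trans (sym (cv-lo p)) (trans (sym eq) (cv-hi′ j)))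
      ...   | ()
      cv-inj a b eq | inj₂ (j , refl , q) | inj₂ (j′ , refl , q′) =
        cong (λ z → suc (suc L₁ + z)) (suc-injective (v-inj R₂ (s≤s q) (s≤s q′) (trans (sym (cv-hi′ j)) (trans eq (cv-hi′ j′)))))

      ce-inj : ∀ {s t} → s ≤ L₁ + suc L₂ → t ≤ L₁ + suc L₂ → ce s ≡ ce t → s ≡ t
      ce-inj a b eq with split L₁ L₂ a | split L₁ L₂ b
      ... | inj₁ p | inj₁ q = e-inj R₁ p q (trans (sym (ce-lo p)) (trans eq (ce-lo q)))
      ... | inj₁ p | inj₂ (j , refl , q) = ⊥-elim (e-disj p q (trans (sym (ce-lo p)) (trans eq (ce-hi j))))
      ... | inj₂ (j , refl , q) | inj₁ p = ⊥-elim (e-disj p q (trans (sym (ce-lo p)) (trans (sym eq) (ce-hi j))))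
      ... | inj₂ (j , refl , q) | inj₂ (j′ , refl , q′) =
        cong (suc L₁ +_) (e-inj R₂ q q′ (trans (sym (ce-hi j)) (trans eq (ce-hi j′))))

      c-link : ∀ {t} → t ≤ L₁ + suc L₂ → Joins G (ce t) (cv t) (cv (suc t))
      c-link {t} a with split L₁ L₂ a
      ... | inj₁ p = subst₂ (λ z w → Joins G z (cv t) w) (sym (ce-lo p)) (sym (cv-lo (s≤s p)))
                       (subst (λ z → Joins G (e R₁ t) z (v R₁ (suc t))) (sym (cv-lo (≤-trans p (n≤1+n _)))) (link R₁ p))
      ... | inj₂ (j , refl , q) = subst₂ (λ z w → Joins G z (cv (suc L₁ + j)) w) (sym (ce-hi j)) (sym (cv-hi′ j))
                       (subst (λ z → Joins G (e R₂ j) z (v R₂ (suc j))) (sym (cv-hi j)) (link R₂ q))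

    concat : RawPath
    concat = record { len = L₁ + suc L₂ ; v = cv ; e = ce ; v-inj = cv-inj ; e-inj = ce-inj ; link = c-link }

    concatE⁻ : ∀ {x} → InE concat x → InE R₁ x ⊎ InE R₂ x
    concatE⁻ (t , a , eq) with split L₁ L₂ a
    ... | inj₁ p = inj₁ (t , p , trans (sym (ce-lo p)) eq)
    ... | inj₂ (j , refl , q) = inj₂ (j , q , trans (sym (ce-hi j)) eq)

    concatE⁺ : ∀ {x} → InE R₁ x ⊎ InE R₂ x → InE concat x
    concatE⁺ (inj₁ (t , p , eq)) = t , ≤-trans p (m≤m+n L₁ _) , trans (ce-lo p) eq
    concatE⁺ (inj₂ (j , q , eq)) =
      suc L₁ + j , ≤-trans (≤-reflexive (sym (+-suc L₁ j))) (+-monoʳ-≤ L₁ (s≤s q)) , trans (ce-hi j) eq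

    concatOn⁻ : ∀ {u} → OnR concat u → OnR R₁ u ⊎ OnR R₂ u
    concatOn⁻ (t , a , eq) with split (suc L₁) L₂ a
    ... | inj₁ p = inj₁ (t , p , trans (sym (cv-lo p)) eq)
    ... | inj₂ (j , refl , q) = inj₂ (suc j , s≤s q , trans (sym (cv-hi′ j)) eq)

    concat-start : v concat 0 ≡ v R₁ 0
    concat-start = cv-lo z≤n

    concat-last : last concat ≡ last R₂
    concat-last = cv-hi (suc L₂)

  prefix suffix : (R : RawPath) (c : ℕ) → suc c ≤ len R → RawPath
  prefix R c p = segment R 0 c (≤-trans (n≤1+n c) p)
  suffix R c p = segment R (suc c) (len R ∸ suc c) (≤-reflexive (m+[n∸m]≡n p))

  module _ (R : RawPath) (c : ℕ) (p : suc c ≤ len R) where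
    private
      fits : suc c + (len R ∸ suc c) ≤ len R
      fits = ≤-reflexive (m+[n∸m]≡n p)

    prefix-or-suffix : ∀ {x} → InE R x → InE (prefix R c p) x ⊎ InE (suffix R c p) x
    prefix-or-suffix (t , t≤ , eq) with t ≤? c
    ... | yes t≤c = inj₁ (t , t≤c , eq)
    ... | no t≰c = inj₂ (segmentE⁺ R (suc c) _ fits (t , ≰⇒> t≰c , subst (t ≤_) (sym (m+[n∸m]≡n p)) t≤ , eq))

    prefixE : ∀ {x} → InE (prefix R c p) x → InE R x
    prefixE (t , t≤ , eq) = t , ≤-trans t≤ (≤-trans (n≤1+n c) p) , eq

    suffixE : ∀ {x} → InE (suffix R c p) x → InE R x
    suffixE h with segmentE⁻ R (suc c) _ fits h
    ... | t , _ , t≤ , eq = t , subst (t ≤_) (m+[n∸m]≡n p) t≤ , eq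

    prefix-suffix-disjoint : ∀ {x} → InE (prefix R c p) x → ¬ InE (suffix R c p) x
    prefix-suffix-disjoint (t , t≤c , refl) h with segmentE⁻ R (suc c) _ fits h
    ... | t′ , c<t′ , t′≤ , eq = <⇒≱ (s≤s t≤c)
      (≤-trans c<t′ (≤-reflexive (e-inj R (≤-trans t′≤ (≤-reflexive (m+[n∸m]≡n p))) (≤-trans t≤c (≤-trans (n≤1+n c) p)) eq)))

    suffix-start : v (suffix R c p) 0 ≡ v R (suc c)
    suffix-start = cong (v R) (+-identityʳ (suc c))

    suffix-last : last (suffix R c p) ≡ last R
    suffix-last = cong (v R) (trans (+-suc (suc c) _) (cong suc (m+[n∸m]≡n p)))

  theta-of : ∀ {x y} → x ≢ y → (R : Fin 3 → RawPath) → (∀ i → v (R i) 0 ≡ x) → (∀ i → last (R i) ≡ y) →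
             (∀ i j → i ≢ j → ∀ {u} → OnR (R i) u → OnR (R j) u → u ≡ x ⊎ u ≡ y) →
             (∀ i j → i ≢ j → ∀ {z} → InE (R i) z → ¬ InE (R j) z) → Theta G
  theta-of {x} {y} x≢y R starts lasts meets disjoint = record
    { x = x ; y = y ; x≢y = x≢y
    ; Q = toPath ∘ R
    ; Q-start = starts
    ; Q-end = λ i → trans (toPath-end (R i)) (lasts i)
    ; int-disj = λ i j i≢j u (on-i , ≢start , ≢end) (on-j , _ , _) →
        [ (λ u≡x → ≢start (trans u≡x (sym (starts i))))
        , (λ u≡y → ≢end (trans u≡y (sym (trans (toPath-end (R i)) (lasts i))))) ]
        (meets i j i≢j (toPath-On⁻ (R i) on-i) (toPath-On⁻ (R j) on-j))
    ; edge-disj = λ i j i≢j z h h′ → disjoint i j i≢j (E⁻ (R i) h) (E⁻ (R j) h′)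
    }

module ClosedSets {n m : ℕ} (G : Graph n m) where
  open RawPaths G

  -- K has no vertex of degree one
  Closed : Subset m → Set
  Closed K = ∀ {x u w} → x ∈ K → Joins G x u w →
             u ≡ w ⊎ ∃ λ x′ → x′ ∈ K × x′ ≢ x × ∃ λ w′ → Joins G x′ u w′

  private
    AnotherEdgeAt : RawPath → ℕ → Fin n → Set
    AnotherEdgeAt R t u = ∃ λ t′ → t′ ≤ len R × e R t′ ≢ e R t × ∃ λ w′ → Joins G (e R t′) u w′

  path-edge-end : ∀ R {t u w} → t ≤ len R → Joins G (e R t) u w →
                  u ≡ v R 0 ⊎ u ≡ last R ⊎ AnotherEdgeAt R t u
  path-edge-end R {t} p j with joins-end j (link R p)
  path-edge-end R {zero} p j | inj₁ eq = inj₁ eq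
  path-edge-end R {suc t} p j | inj₁ eq =
    inj₂ (inj₂ (t , t≤ , (λ h → 1+n≢n (sym (e-inj R t≤ p h))) , v R t ,
                subst (λ z → Joins G (e R t) z (v R t)) (sym eq) (joins-sym (link R t≤))))
    where t≤ = ≤-trans (n≤1+n t) p
  path-edge-end R {t} p j | inj₂ eq with m≤n⇒m<n∨m≡n p
  ... | inj₂ refl = inj₂ (inj₁ eq)
  ... | inj₁ t<len = inj₂ (inj₂ (suc t , t<len , (λ h → 1+n≢n (e-inj R t<len p h)) , v R (suc (suc t)) ,
                                 subst (λ z → Joins G (e R (suc t)) z (v R (suc (suc t)))) (sym eq) (link R t<len)))

  private
    edge-beside : ∀ A B → v A 0 ≡ v B 0 → last A ≡ last B → (∀ {x} → InE A x → ¬ InE B x) →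
                  ∀ {x u w} → InE A x → Joins G x u w →
                  ∃ λ x′ → (InE A x′ ⊎ InE B x′) × x′ ≢ x × ∃ λ w′ → Joins G x′ u w′
    edge-beside A B s≡ t≡ disj (t , p , refl) j with path-edge-end A p j
    ... | inj₁ eq = e B 0 , inj₂ (0 , z≤n , refl) , (λ h → disj (t , p , refl) (0 , z≤n , h)) , v B 1 ,
                    subst (λ z → Joins G (e B 0) z (v B 1)) (sym (trans eq s≡)) (link B z≤n)
    ... | inj₂ (inj₁ eq) = e B (len B) , inj₂ (len B , ≤-refl , refl) , (λ h → disj (t , p , refl) (len B , ≤-refl , h)) ,
                    v B (len B) , subst (λ z → Joins G (e B (len B)) z (v B (len B))) (sym (trans eq t≡)) (joins-sym (link B ≤-refl))
    ... | inj₂ (inj₂ (t′ , p′ , ne , w′ , j′)) = e A t′ , inj₁ (t′ , p′ , refl) , ne , w′ , j′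

  two-paths-closed : ∀ R₁ R₂ → v R₁ 0 ≡ v R₂ 0 → last R₁ ≡ last R₂ →
                     (∀ {x} → InE R₁ x → ¬ InE R₂ x) → Closed (E R₁ ∪ E R₂)
  two-paths-closed R₁ R₂ s≡ t≡ disj h j with x∈p∪q⁻ (E R₁) (E R₂) h
  ... | inj₁ h₁ = let (x′ , q , ne , w′ , j′) = edge-beside R₁ R₂ s≡ t≡ disj (E⁻ R₁ h₁) j in
                  inj₂ (x′ , x∈p∪q⁺ (Sum.map (E⁺ R₁) (E⁺ R₂) q) , ne , w′ , j′)
  ... | inj₂ h₂ = let (x′ , q , ne , w′ , j′) = edge-beside R₂ R₁ (sym s≡) (sym t≡) (λ a b → disj b a) (E⁻ R₂ h₂) j in
                  inj₂ (x′ , x∈p∪q⁺ (Sum.map (E⁺ R₁) (E⁺ R₂) (Sum.swap q)) , ne , w′ , j′)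

  -- a cycle given by its raw data, so that its length can be matched on
  cycle-closed′ : ∀ {l} {vt : Fin (suc l) → Fin n} {ed : Fin (suc l) → Fin m} →
    Injective _≡_ _≡_ vt → Injective _≡_ _≡_ ed →
    (∀ i → Joins G (ed (inject₁ i)) (vt (inject₁ i)) (vt (suc i))) →
    Joins G (ed (fromℕ l)) (vt (fromℕ l)) (vt zero) → Closed (image ed)
  cycle-closed′ {zero} {ed = ed} _ _ _ close h j with ∈-image⁻ ed h
  ... | zero , refl with joins-ends j close
  ...   | inj₁ (u≡ , w≡) = inj₁ (trans u≡ (sym w≡))
  ...   | inj₂ (u≡ , w≡) = inj₁ (trans u≡ (sym w≡))
  cycle-closed′ {suc l} {vt} {ed} vt-inj ed-inj lnk close {x} {u} {w} h j = closed-at (∈-image⁻ ed h)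
    where
    open-path : Path G
    open-path = record { len = l ; vtx = vt ; edg = ed ∘ inject₁ ; vtx-inj = vt-inj
                       ; edg-inj = inject₁-injective ∘ ed-inj ; link = lnk }
    R = fromPath open-path
    ec = ed (fromℕ (suc l))

    ec≢ : ∀ t → e R t ≢ ec
    ec≢ t eq = fromℕ≢inject₁ (ed-inj (sym eq))

    ek : ∀ k → e R (toℕ k) ≡ ed (inject₁ k)
    ek k = cong (ed ∘ inject₁) (clamp-toℕ k)

    Result : Fin m → Set
    Result x = u ≡ w ⊎ ∃ λ x′ → x′ ∈ image ed × x′ ≢ x × ∃ λ w′ → Joins G x′ u w′

    closing-edge : u ≡ v R 0 ⊎ u ≡ last R → ∀ {k} → Result (ed (inject₁ k))
    closing-edge (inj₁ refl) = inj₂ (ec , ∈-image⁺ ed _ , (λ eq → fromℕ≢inject₁ (ed-inj eq)) , vt (fromℕ (suc l)) ,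
                                      subst (λ z → Joins G ec z (vt (fromℕ (suc l)))) (sym (fromPath-start open-path)) (joins-sym close))
    closing-edge (inj₂ refl) = inj₂ (ec , ∈-image⁺ ed _ , (λ eq → fromℕ≢inject₁ (ed-inj eq)) , vt zero ,
                                      subst (λ z → Joins G ec z (vt zero)) (sym (fromPath-end open-path)) close)

    closed-at : (∃ λ i → ed i ≡ x) → Result x
    closed-at (i , refl) with fromℕ-or-inject₁ i
    ... | inj₁ refl with joins-end j close
    ...   | inj₁ refl = inj₂ (e R l , ∈-image⁺ ed _ , ec≢ l , v R l ,
                              subst (λ z → Joins G (e R l) z (v R l)) (fromPath-end open-path) (joins-sym (link R ≤-refl)))
    ...   | inj₂ refl = inj₂ (e R 0 , ∈-image⁺ ed _ , ec≢ 0 , v R 1 ,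
                              subst (λ z → Joins G (e R 0) z (v R 1)) (fromPath-start open-path) (link R z≤n))
    closed-at (i , refl) | inj₂ (k , refl)
      with path-edge-end R (toℕ≤pred[n] k) (subst (λ z → Joins G z u w) (sym (ek k)) j)
    ... | inj₁ eq = closing-edge (inj₁ eq)
    ... | inj₂ (inj₁ eq) = closing-edge (inj₂ eq)
    ... | inj₂ (inj₂ (t′ , _ , ne , w′ , j′)) =
      inj₂ (e R t′ , ∈-image⁺ ed _ , (λ eq → ne (trans eq (sym (ek k)))) , w′ , j′)

  cycle-closed : (C : Cycle G) → Closed (cycleEdges C)
  cycle-closed C = cycle-closed′ {vt = Cycle.vtx C} {Cycle.edg C} (Cycle.vtx-inj C) (Cycle.edg-inj C) (Cycle.link C) (Cycle.close C)

  BarePath : Subset m → RawPath → Set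
  BarePath X R = ∀ {j x w} → j < len R → x ∈ X → Joins G x (v R (suc j)) w → x ≡ e R j ⊎ x ≡ e R (suc j)

  module _ {X K : Subset m} (K-closed : Closed K) (K⊆X : K ⊆ X) (R : RawPath) (bare : BarePath X R) where
    private
      step-up : ∀ {t} → suc t ≤ len R → e R t ∈ K → e R (suc t) ∈ K
      step-up {t} p h with K-closed h (joins-sym (link R (≤-trans (n≤1+n t) p)))
      ... | inj₁ eq = ⊥-elim (1+n≢n (v-inj R (s≤s (≤-trans (n≤1+n t) p)) (≤-trans (n≤1+n t) (s≤s (≤-trans (n≤1+n t) p))) eq))
      ... | inj₂ (x′ , x′∈K , x′≢ , _ , j′) with bare p (K⊆X x′∈K) j′
      ...   | inj₁ eq = ⊥-elim (x′≢ eq)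
      ...   | inj₂ eq = subst (_∈ K) eq x′∈K

      step-down : ∀ {t} → suc t ≤ len R → e R (suc t) ∈ K → e R t ∈ K
      step-down {t} p h with K-closed h (link R p)
      ... | inj₁ eq = ⊥-elim (1+n≢n (sym (v-inj R (s≤s (≤-trans (n≤1+n t) p)) (s≤s p) eq)))
      ... | inj₂ (x′ , x′∈K , x′≢ , _ , j′) with bare p (K⊆X x′∈K) j′
      ...   | inj₁ eq = subst (_∈ K) eq x′∈K
      ...   | inj₂ eq = ⊥-elim (x′≢ eq)

      down-to-0 : ∀ {t} → t ≤ len R → e R t ∈ K → e R 0 ∈ K
      down-to-0 {zero} _ h = h
      down-to-0 {suc t} p h = down-to-0 (≤-trans (n≤1+n t) p) (step-down p h)

      up-from-0 : ∀ {t} → t ≤ len R → e R 0 ∈ K → e R t ∈ K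
      up-from-0 {zero} _ h = h
      up-from-0 {suc t} p h = step-up p (up-from-0 (≤-trans (n≤1+n t) p) h)

    all-or-none : ∀ {s t} → s ≤ len R → t ≤ len R → e R s ∈ K → e R t ∈ K
    all-or-none s≤ t≤ h = up-from-0 t≤ (down-to-0 s≤ h)

module FrameCircuits {n m : ℕ} (Ω : BiasedGraph n m) where
  private G = graph Ω
  open RawPaths G
  open ClosedSets G

  theta-cycle-closed : (T : Theta G) (i j : Fin 3) → i ≢ j → Closed (Theta.cyc T i j)
  theta-cycle-closed T i j i≢j =
    subst₂ (λ A B → Closed (A ∪ B)) (fromPath-E (Q i)) (fromPath-E (Q j))
      (two-paths-closed (fromPath (Q i)) (fromPath (Q j))
        (trans (fromPath-start (Q i)) (trans (Q-start i) (sym (trans (fromPath-start (Q j)) (Q-start j)))))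
        (trans (fromPath-end (Q i)) (trans (Q-end i) (sym (trans (fromPath-end (Q j)) (Q-end j)))))
        (λ {x} h₁ h₂ → edge-disj i j i≢j x (subst (x ∈_) (fromPath-E (Q i)) (E⁺ (fromPath (Q i)) h₁))
                                           (subst (x ∈_) (fromPath-E (Q j)) (E⁺ (fromPath (Q j)) h₂))))
    where open Theta T

  theta-path⊆edges : (T : Theta G) (i : Fin 3) → pathEdges (Theta.Q T i) ⊆ Theta.edges T
  theta-path⊆edges T zero = p⊆p∪q _
  theta-path⊆edges T (suc zero) = q⊆p∪q _ _ ∘ p⊆p∪q _
  theta-path⊆edges T (suc (suc zero)) = q⊆p∪q _ _ ∘ q⊆p∪q _ _

  theta-cycle⊆edges : (T : Theta G) (i j : Fin 3) → Theta.cyc T i j ⊆ Theta.edges T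
  theta-cycle⊆edges T i j h = [ theta-path⊆edges T i , theta-path⊆edges T j ] (x∈p∪q⁻ _ _ h)

  private
    first-edge : (C : Cycle G) → Cycle.edg C zero ∈ cycleEdges C
    first-edge C = ∈-image⁺ (Cycle.edg C) zero

    first-edge-joins : (C : Cycle G) → ∃ λ w → Joins G (Cycle.edg C zero) (Cycle.vtx C zero) w
    first-edge-joins C = from-links {vt = Cycle.vtx C} {Cycle.edg C} (Cycle.link C) (Cycle.close C)
      where
      from-links : ∀ {l} {vt : Fin (suc l) → Fin n} {ed : Fin (suc l) → Fin m} →
                   (∀ i → Joins G (ed (inject₁ i)) (vt (inject₁ i)) (vt (suc i))) →
                   Joins G (ed (fromℕ l)) (vt (fromℕ l)) (vt zero) → ∃ λ w → Joins G (ed zero) (vt zero) w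
      from-links {zero} _ close = _ , close
      from-links {suc _} lnk _ = _ , lnk zero

    edge-ends-on-cycle : (C : Cycle G) (i : Fin (suc (Cycle.len C))) → ∀ {p q} →
                         Joins G (Cycle.edg C i) p q → OnCycle C p
    edge-ends-on-cycle C i jn with fromℕ-or-inject₁ i
    ... | inj₁ refl = [ (λ eq → _ , sym eq) , (λ eq → _ , sym eq) ] (joins-end jn (Cycle.close C))
    ... | inj₂ (k , refl) = [ (λ eq → _ , sym eq) , (λ eq → _ , sym eq) ] (joins-end jn (Cycle.link C k))

  -- A balanced cycle is a nonempty closed set, and every other frame circuit
  -- contains two distinct ones (two of its cycles); so no circuit fits into S
  -- when its only nonempty closed subset is the unbalanced D.
  independent-if-unique-closed : (S D : Subset m) → balanced Ω D ≡ false →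
    (∀ K → Closed K → K ⊆ S → ∀ {x} → x ∈ K → K ≡ D) → FrameIndep Ω S
  independent-if-unique-closed S D D-unbal unique _ (balanced-cycle C C-bal) C⊆S
    with trans (sym D-unbal) (trans (cong (balanced Ω) (sym (unique _ (cycle-closed C) C⊆S (first-edge C)))) C-bal)
  ... | ()
  independent-if-unique-closed S D _ unique _ (tight-handcuff C₁ C₂ _ _ disj _ _ _ _) sub =
    disj _ (first-edge C₁) (subst (_ ∈_) (trans D₁ (sym D₂)) (first-edge C₁))
    where
    D₁ = unique (cycleEdges C₁) (cycle-closed C₁) (sub ∘ p⊆p∪q _) (first-edge C₁)
    D₂ = unique (cycleEdges C₂) (cycle-closed C₂) (sub ∘ q⊆p∪q _ _) (first-edge C₂)
  independent-if-unique-closed S D _ unique _ (loose-handcuff C₁ C₂ _ _ vdisj P _ _ _ _) sub =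
    shared-edge (∈-image⁻ (Cycle.edg C₂) (subst (_ ∈_) (trans D₁ (sym D₂)) (first-edge C₁)))
    where
    D₁ = unique (cycleEdges C₁) (cycle-closed C₁) (sub ∘ p⊆p∪q _) (first-edge C₁)
    D₂ = unique (cycleEdges C₂) (cycle-closed C₂) (sub ∘ q⊆p∪q _ _ ∘ p⊆p∪q (pathEdges P)) (first-edge C₂)
    shared-edge : (∃ λ i → Cycle.edg C₂ i ≡ Cycle.edg C₁ zero) → ⊥
    shared-edge (i , eq) with first-edge-joins C₁
    ... | w , jn = vdisj _ (zero , refl)
      (edge-ends-on-cycle C₂ i (subst (λ z → Joins G z (Cycle.vtx C₁ zero) w) (sym eq) jn))
  independent-if-unique-closed S D _ unique _ (contra-theta T _) sub =
    Q₁-edge (x∈p∪q⁻ (pathEdges (Q zero)) (pathEdges (Q (suc (suc zero))))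
               (subst (_ ∈_) (trans D₀₁ (sym D₀₂)) (q⊆p∪q (pathEdges (Q zero)) _ (first (suc zero)))))
    where
    open Theta T
    first : ∀ i → Path.edg (Q i) zero ∈ pathEdges (Q i)
    first i = ∈-image⁺ (Path.edg (Q i)) zero
    cyc⊆S : ∀ i j → cyc i j ⊆ S
    cyc⊆S i j = sub ∘ theta-cycle⊆edges T i j
    D₀₁ = unique (cyc zero (suc zero)) (theta-cycle-closed T zero (suc zero) (λ ())) (cyc⊆S _ _)
                 (p⊆p∪q _ (first zero))
    D₀₂ = unique (cyc zero (suc (suc zero))) (theta-cycle-closed T zero (suc (suc zero)) (λ ())) (cyc⊆S _ _)
                 (p⊆p∪q _ (first zero))
    Q₁-edge : Path.edg (Q (suc zero)) zero ∈ pathEdges (Q zero) ⊎ Path.edg (Q (suc zero)) zero ∈ pathEdges (Q (suc (suc zero))) → ⊥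
    Q₁-edge (inj₁ h) = edge-disj (suc zero) zero (λ ()) _ (first (suc zero)) h
    Q₁-edge (inj₂ h) = edge-disj (suc zero) (suc (suc zero)) (λ ()) _ (first (suc zero)) h

  private
    balanced-theta-cycle : (T : Theta G) (i j : Fin 3) → balanced Ω (Theta.cyc T i j) ≡ true →
                           ∃ λ S → FrameCircuit Ω S × S ⊆ Theta.edges T
    balanced-theta-cycle T i j bal with balanced-cyc Ω (Theta.cyc T i j) bal
    ... | C , eq = cycleEdges C , balanced-cycle C (trans (cong (balanced Ω) eq) bal) ,
                   subst (_⊆ Theta.edges T) (sym eq) (theta-cycle⊆edges T i j)

  theta-contains-circuit : (T : Theta G) → ∃ λ S → FrameCircuit Ω S × S ⊆ Theta.edges T
  theta-contains-circuit T
    with balanced Ω (cyc zero (suc zero)) in b₀₁ | balanced Ω (cyc zero (suc (suc zero))) in b₀₂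
       | balanced Ω (cyc (suc zero) (suc (suc zero))) in b₁₂
    where open Theta T
  ... | true | _ | _ = balanced-theta-cycle T zero (suc zero) b₀₁
  ... | false | true | _ = balanced-theta-cycle T zero (suc (suc zero)) b₀₂
  ... | false | false | true = balanced-theta-cycle T (suc zero) (suc (suc zero)) b₁₂
  ... | false | false | false = Theta.edges T , contra-theta T contrabalanced , (λ h → h)
    where
    open Theta T
    flip-pair : ∀ {i j} → balanced Ω (cyc i j) ≡ false → balanced Ω (cyc j i) ≡ false
    flip-pair {i} {j} u = trans (cong (balanced Ω) (∪-comm (pathEdges (Q j)) (pathEdges (Q i)))) u
    contrabalanced : Contrabalanced Ω T
    contrabalanced zero zero ne = ⊥-elim (ne refl)
    contrabalanced zero (suc zero) _ = b₀₁
    contrabalanced zero (suc (suc zero)) _ = b₀₂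
    contrabalanced (suc zero) zero _ = flip-pair b₀₁
    contrabalanced (suc zero) (suc zero) ne = ⊥-elim (ne refl)
    contrabalanced (suc zero) (suc (suc zero)) _ = b₁₂
    contrabalanced (suc (suc zero)) zero _ = flip-pair b₀₂
    contrabalanced (suc (suc zero)) (suc zero) _ = flip-pair b₁₂
    contrabalanced (suc (suc zero)) (suc (suc zero)) ne = ⊥-elim (ne refl)

-- K₄ with nodes 𝐱 𝐲 (the branch vertices) and 𝐚 𝐛 (the ends of the shortcut);
-- a segment is named by its tail and head.
Node = Fin 4
pattern 𝐱 = zero
pattern 𝐲 = suc zero
pattern 𝐚 = suc (suc zero)
pattern 𝐛 = suc (suc (suc zero))

Segment = Fin 6
pattern xa = zero
pattern ay = suc zero
pattern xb = suc (suc zero)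
pattern by = suc (suc (suc zero))
pattern xy = suc (suc (suc (suc zero)))
pattern ab = suc (suc (suc (suc (suc zero))))

tail head : Segment → Node
tail xa = 𝐱
tail ay = 𝐚
tail xb = 𝐱
tail by = 𝐛
tail xy = 𝐱
tail ab = 𝐚
head xa = 𝐚
head ay = 𝐲
head xb = 𝐛
head by = 𝐲
head xy = 𝐲
head ab = 𝐛

Ends : Node → Segment → Set
Ends ν σ = ν ≡ tail σ ⊎ ν ≡ head σ

ends? : ∀ ν σ → Dec (Ends ν σ)
ends? ν σ = (ν ≟ᶠ tail σ) ⊎-dec (ν ≟ᶠ head σ)

Leafless : Subset 6 → Set
Leafless p = ∀ ν σ → σ ∈ p → Ends ν σ → ∃ λ τ → τ ∈ p × Ends ν τ × τ ≢ σ

leafless? : ∀ p → Dec (Leafless p)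
leafless? p = all? λ ν → all? λ σ → (σ ∈? p) →-dec (ends? ν σ →-dec
  any? λ τ → (τ ∈? p) ×-dec (ends? ν τ ×-dec ¬? (τ ≟ᶠ σ)))

all-subsets? : ∀ {k} {Q : Subset k → Set} → Decidable Q → Dec (∀ p → Q p)
all-subsets? Q? with anySubset? (λ p → ¬? (Q? p))
... | yes (p , ¬Qp) = no λ ∀Q → ¬Qp (∀Q p)
... | no ∄ = yes λ p → decidable-stable (Q? p) λ ¬Qp → ∄ (p , ¬Qp)

abstract
  joined : ∀ ν μ → ν ≢ μ → ∃ λ σ → (ν ≡ tail σ × μ ≡ head σ) ⊎ (μ ≡ tail σ × ν ≡ head σ)
  joined = toWitness {a? = all? λ ν → all? λ μ → ¬? (ν ≟ᶠ μ) →-dec any? λ σ →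
    ((ν ≟ᶠ tail σ) ×-dec (μ ≟ᶠ head σ)) ⊎-dec ((μ ≟ᶠ tail σ) ×-dec (ν ≟ᶠ head σ))} _

abstract
  tail≢head : ∀ σ → tail σ ≢ head σ
  tail≢head = toWitness {a? = all? λ σ → ¬? (tail σ ≟ᶠ head σ)} _

abstract
  another-segment-at : ∀ ν τ → ∃ λ σ → Ends ν σ × σ ≢ τ
  another-segment-at = toWitness {a? = all? λ ν → all? λ τ → any? λ σ → ends? ν σ ×-dec ¬? (σ ≟ᶠ τ)} _

-- the theta path (just r) or the shortcut (nothing) carrying a segment
track : Segment → Maybe (Fin 3)
track xa = just zero
track ay = just zero
track xb = just (suc zero)
track by = just (suc zero)
track xy = just (suc (suc zero))
track ab = nothing

abstract
  same-track : ∀ σ τ → σ ≢ τ → track σ ≡ track τ →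
    (σ ≡ xa × τ ≡ ay) ⊎ (σ ≡ ay × τ ≡ xa) ⊎ (σ ≡ xb × τ ≡ by) ⊎ (σ ≡ by × τ ≡ xb)
  same-track = toWitness {a? = all? λ σ → all? λ τ → ¬? (σ ≟ᶠ τ) →-dec (≡-dec-Maybe _≟ᶠ_ (track σ) (track τ) →-dec
    (((σ ≟ᶠ xa) ×-dec (τ ≟ᶠ ay)) ⊎-dec (((σ ≟ᶠ ay) ×-dec (τ ≟ᶠ xa)) ⊎-dec
     (((σ ≟ᶠ xb) ×-dec (τ ≟ᶠ by)) ⊎-dec ((σ ≟ᶠ by) ×-dec (τ ≟ᶠ xb))))))} _

LeaflessAvoiding : Segment → Segment → Subset 6 → Set
LeaflessAvoiding σ τ p = Leafless p × Nonempty p × σ ∉ p × τ ∉ p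

leaflessAvoiding? : ∀ σ τ p → Dec (LeaflessAvoiding σ τ p)
leaflessAvoiding? σ τ p = leafless? p ×-dec (nonempty? p ×-dec (¬? (σ ∈? p) ×-dec ¬? (τ ∈? p)))

private
  -- K₄ minus σ and τ: drop the third segment at a common end of σ and τ, if any
  cycle-avoiding : Segment → Segment → Subset 6
  cycle-avoiding σ τ = tabulate λ ρ → not (does (ρ ≟ᶠ σ)) ∧ not (does (ρ ≟ᶠ τ)) ∧
    not (does (any? λ ν → ends? ν ρ ×-dec (ends? ν σ ×-dec ends? ν τ)))

  abstract
    leaflessAvoiding⇒cycle : ∀ σ τ → σ ≢ τ → ∀ p → LeaflessAvoiding σ τ p → p ≡ cycle-avoiding σ τ
    leaflessAvoiding⇒cycle = toWitness {a? = all? λ σ → all? λ τ → ¬? (σ ≟ᶠ τ) →-dec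
      all-subsets? λ p → leaflessAvoiding? σ τ p →-dec ≡-dec _≟ᵇ_ p (cycle-avoiding σ τ)} _

leaflessAvoiding-unique : ∀ {σ τ} → σ ≢ τ → ∀ {p q} → LeaflessAvoiding σ τ p → LeaflessAvoiding σ τ q → p ≡ q
leaflessAvoiding-unique σ≢τ lp lq = trans (leaflessAvoiding⇒cycle _ _ σ≢τ _ lp) (sym (leaflessAvoiding⇒cycle _ _ σ≢τ _ lq))

other : Node → Segment → Node
other ν σ = if does (ν ≟ᶠ tail σ) then head σ else tail σ

abstract
  other-tail : ∀ σ → other (tail σ) σ ≡ head σ
  other-tail = toWitness {a? = all? λ σ → other (tail σ) σ ≟ᶠ head σ} _

abstract
  other-head : ∀ σ → other (head σ) σ ≡ tail σ
  other-head = toWitness {a? = all? λ σ → other (head σ) σ ≟ᶠ tail σ} _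

-- K₄ minus ρ is a theta: from hub ρ to rim ρ run the segment direct ρ and,
-- for k = 0, 1, the segments first ρ k and second ρ k through mid ρ k.
hub : Segment → Node
hub xa = 𝐛
hub ay = 𝐱
hub xb = 𝐚
hub by = 𝐱
hub xy = 𝐚
hub ab = 𝐱

direct : Segment → Segment
direct xa = by
direct ay = xb
direct xb = ay
direct by = xa
direct xy = ab
direct ab = xy

first second : Segment → Fin 2 → Segment
first xa zero = xb
first xa (suc zero) = ab
first ay zero = xa
first ay (suc zero) = xy
first xb zero = xa
first xb (suc zero) = ab
first by zero = xb
first by (suc zero) = xy
first xy zero = xa
first xy (suc zero) = ay
first ab zero = xa
first ab (suc zero) = xb
second xa zero = xy
second xa (suc zero) = ay
second ay zero = ab
second ay (suc zero) = by
second xb zero = xy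
second xb (suc zero) = by
second by zero = ab
second by (suc zero) = ay
second xy zero = xb
second xy (suc zero) = by
second ab zero = ay
second ab (suc zero) = by

rim : Segment → Node
rim ρ = other (hub ρ) (direct ρ)

mid : Segment → Fin 2 → Node
mid ρ k = other (hub ρ) (first ρ k)

route : Segment → Fin 3 → Subset 6
route ρ zero = ⁅ direct ρ ⁆
route ρ (suc k) = ⁅ first ρ k ⁆ ∪ ⁅ second ρ k ⁆

abstract
  plan-direct : ∀ ρ → Ends (hub ρ) (direct ρ) × hub ρ ≢ rim ρ
  plan-direct = toWitness {a? = all? λ ρ → ends? (hub ρ) (direct ρ) ×-dec ¬? (hub ρ ≟ᶠ rim ρ)} _

abstract
  plan-detour : ∀ ρ k → Ends (hub ρ) (first ρ k) × Ends (mid ρ k) (second ρ k) × first ρ k ≢ second ρ k ×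
    (∀ μ → Ends μ (first ρ k) → Ends μ (second ρ k) → μ ≡ mid ρ k) × other (mid ρ k) (second ρ k) ≡ rim ρ
  plan-detour = toWitness {a? = all? λ ρ → all? λ k → ends? (hub ρ) (first ρ k) ×-dec (ends? (mid ρ k) (second ρ k)
    ×-dec (¬? (first ρ k ≟ᶠ second ρ k) ×-dec ((all? λ μ → ends? μ (first ρ k) →-dec (ends? μ (second ρ k) →-dec
    (μ ≟ᶠ mid ρ k))) ×-dec (other (mid ρ k) (second ρ k) ≟ᶠ rim ρ))))} _

abstract
  plan-crossing : ∀ ρ i j → i ≢ j → ∀ σ τ → σ ∈ route ρ i → τ ∈ route ρ j →
    σ ≢ τ × (∀ μ → Ends μ σ → Ends μ τ → μ ≡ hub ρ ⊎ μ ≡ rim ρ)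
  plan-crossing = toWitness {a? = all? λ ρ → all? λ i → all? λ j → ¬? (i ≟ᶠ j) →-dec all? λ σ → all? λ τ →
    (σ ∈? route ρ i) →-dec ((τ ∈? route ρ j) →-dec (¬? (σ ≟ᶠ τ) ×-dec all? λ μ → ends? μ σ →-dec (ends? μ τ →-dec
    ((μ ≟ᶠ hub ρ) ⊎-dec (μ ≟ᶠ rim ρ)))))} _

abstract
  plan-avoids : ∀ ρ i → ρ ∉ route ρ i
  plan-avoids = toWitness {a? = all? λ ρ → all? λ i → ¬? (ρ ∈? route ρ i)} _

along : Fin 3 → Subset 6
along r = tabulate λ σ → does (≡-dec-Maybe _≟ᶠ_ (track σ) (just r))

∈along⁺ : ∀ {r σ} → track σ ≡ just r → σ ∈ along r
∈along⁺ {r} {σ} on = ∈-tabulate⁺ (λ τ → does (≡-dec-Maybe _≟ᶠ_ (track τ) (just r))) (dec-true (≡-dec-Maybe _≟ᶠ_ (track σ) (just r)) on)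

∈along⁻ : ∀ {r σ} → σ ∈ along r → track σ ≡ just r
∈along⁻ {r} {σ} σ∈ = does⇒ (≡-dec-Maybe _≟ᶠ_ (track σ) (just r)) (∈-tabulate⁻ (λ τ → does (≡-dec-Maybe _≟ᶠ_ (track τ) (just r))) σ∈)

Q-cycle : Fin 3 → Subset 6
Q-cycle zero = along (suc zero) ∪ along (suc (suc zero))
Q-cycle (suc zero) = along zero ∪ along (suc (suc zero))
Q-cycle (suc (suc zero)) = along zero ∪ along (suc zero)

-- For c = 0 (resp. 1) keep the three segments at 𝐱 (resp. 𝐲) and ab; the
-- triangle through ab avoiding that branch vertex then has to be unbalanced.
kept : Fin 2 → Fin 4 → Segment
kept zero zero = xa
kept zero (suc zero) = xb
kept zero (suc (suc zero)) = ab
kept zero (suc (suc (suc zero))) = xy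
kept (suc zero) zero = ay
kept (suc zero) (suc zero) = by
kept (suc zero) (suc (suc zero)) = ab
kept (suc zero) (suc (suc (suc zero))) = xy

triangle : Fin 2 → Subset 6
triangle zero = ⁅ ay ⁆ ∪ (⁅ ab ⁆ ∪ ⁅ by ⁆)
triangle (suc zero) = ⁅ xa ⁆ ∪ (⁅ ab ⁆ ∪ ⁅ xb ⁆)

candidate : Fin 2 → Fin 4 → Subset 6
candidate c zero = triangle c
candidate c (suc k) = Q-cycle k

abstract
  kept-injective : ∀ c r s → kept c r ≡ kept c s → r ≡ s
  kept-injective = toWitness {a? = all? λ c → all? λ r → all? λ s → (kept c r ≟ᶠ kept c s) →-dec (r ≟ᶠ s)} _

  kept-cycles : ∀ c r s → r ≢ s → ∃ λ k → LeaflessAvoiding (kept c r) (kept c s) (candidate c k)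
  kept-cycles = toWitness {a? = all? λ c → all? λ r → all? λ s → ¬? (r ≟ᶠ s) →-dec
    any? λ k → leaflessAvoiding? (kept c r) (kept c s) (candidate c k)} _

arrange : Fin 3 → Fin 3 → Fin 3 → Fin 3
arrange i j zero = i
arrange i j (suc zero) = j
arrange zero (suc zero) (suc (suc zero)) = suc (suc zero)
arrange (suc zero) zero (suc (suc zero)) = suc (suc zero)
arrange zero (suc (suc zero)) (suc (suc zero)) = suc zero
arrange (suc (suc zero)) zero (suc (suc zero)) = suc zero
arrange _ _ (suc (suc zero)) = zero

abstract
  arrange-injective : ∀ i j → i ≢ j → ∀ r s → r ≢ s → arrange i j r ≢ arrange i j s
  arrange-injective = toWitness {a? = all? λ i → all? λ j → ¬? (i ≟ᶠ j) →-dec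
    all? λ r → all? λ s → ¬? (r ≟ᶠ s) →-dec ¬? (arrange i j r ≟ᶠ arrange i j s)} _

abstract
  two-outside : ∀ (I : Subset 4) → ∣ I ∣ ≤ 2 → ∃ λ r → ∃ λ s → r ≢ s × r ∉ I × s ∉ I
  two-outside = toWitness {a? = all-subsets? λ I → (∣ I ∣ ≤? 2) →-dec
    any? λ r → any? λ s → ¬? (r ≟ᶠ s) ×-dec (¬? (r ∈? I) ×-dec ¬? (s ∈? I))} _

abstract
  all-but-one-inside : ∀ (I : Subset 4) → ¬ ∣ I ∣ ≤ 2 → ∃ λ r → ∀ i → i ≢ r → i ∈ I
  all-but-one-inside = toWitness {a? = all-subsets? λ I → ¬? (∣ I ∣ ≤? 2) →-dec
    any? λ r → all? λ i → ¬? (i ≟ᶠ r) →-dec (i ∈? I)} _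

module Subdivision {n m : ℕ} (Ω : BiasedGraph n m) where
  private G = graph Ω
  open RawPaths G
  open ClosedSets G
  open FrameCircuits Ω

  record ShortcutTheta : Set where
    field
      x y        : Fin n
      x≢y        : x ≢ y
      Q          : Fin 3 → RawPath
      Q-start    : ∀ r → v (Q r) 0 ≡ x
      Q-last     : ∀ r → last (Q r) ≡ y
      Q-meet     : ∀ {r s} → r ≢ s → ∀ {t t′} → t ≤ suc (len (Q r)) → t′ ≤ suc (len (Q s)) →
                   v (Q r) t ≡ v (Q s) t′ → v (Q r) t ≡ x ⊎ v (Q r) t ≡ y
      Q-disj     : ∀ {r s} → r ≢ s → ∀ {z} → InE (Q r) z → ¬ InE (Q s) z
      P          : RawPath
      α β        : ℕ
      α<         : suc α ≤ len (Q zero)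
      β<         : suc β ≤ len (Q (suc zero))
      P-start    : v P 0 ≡ v (Q zero) (suc α)
      P-last     : last P ≡ v (Q (suc zero)) (suc β)
      P-avoids-v : ∀ {t} → 1 ≤ t → t ≤ len P → ∀ r {t′} → t′ ≤ suc (len (Q r)) → v P t ≢ v (Q r) t′
      P-avoids-e : ∀ {z} → InE P z → ∀ r → ¬ InE (Q r) z

  module _ (S : ShortcutTheta) where
    open ShortcutTheta S

    seg : Segment → RawPath
    seg xa = prefix (Q zero) α α<
    seg ay = suffix (Q zero) α α<
    seg xb = prefix (Q (suc zero)) β β<
    seg by = suffix (Q (suc zero)) β β<
    seg xy = Q (suc (suc zero))
    seg ab = P

    node : Node → Fin n
    node 𝐱 = x
    node 𝐲 = y
    node 𝐚 = v (Q zero) (suc α)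
    node 𝐛 = v (Q (suc zero)) (suc β)

    seg-start : ∀ σ → v (seg σ) 0 ≡ node (tail σ)
    seg-start xa = Q-start zero
    seg-start ay = suffix-start (Q zero) α α<
    seg-start xb = Q-start (suc zero)
    seg-start by = suffix-start (Q (suc zero)) β β<
    seg-start xy = Q-start (suc (suc zero))
    seg-start ab = P-start

    seg-last : ∀ σ → last (seg σ) ≡ node (head σ)
    seg-last xa = refl
    seg-last ay = trans (suffix-last (Q zero) α α<) (Q-last zero)
    seg-last xb = refl
    seg-last by = trans (suffix-last (Q (suc zero)) β β<) (Q-last (suc zero))
    seg-last xy = Q-last (suc (suc zero))
    seg-last ab = P-last

    node-injective : ∀ {ν μ} → node ν ≡ node μ → ν ≡ μ
    node-injective {ν} {μ} eq with ν ≟ᶠ μ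
    ... | yes ν≡μ = ν≡μ
    ... | no ν≢μ with joined ν μ ν≢μ
    ...   | σ , inj₁ (refl , refl) = ⊥-elim (0≢1+n (v-inj (seg σ) z≤n ≤-refl
                                       (trans (seg-start σ) (trans eq (sym (seg-last σ))))))
    ...   | σ , inj₂ (refl , refl) = ⊥-elim (0≢1+n (v-inj (seg σ) z≤n ≤-refl
                                       (trans (seg-start σ) (trans (sym eq) (sym (seg-last σ))))))

    trackPath : Maybe (Fin 3) → RawPath
    trackPath (just r) = Q r
    trackPath nothing = P

    seg⊆track : ∀ σ {z} → InE (seg σ) z → InE (trackPath (track σ)) z
    seg⊆track xa = prefixE (Q zero) α α<
    seg⊆track ay = suffixE (Q zero) α α<
    seg⊆track xb = prefixE (Q (suc zero)) β β<
    seg⊆track by = suffixE (Q (suc zero)) β β<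
    seg⊆track xy h = h
    seg⊆track ab h = h

    tracks-disjoint : ∀ k l → k ≢ l → ∀ {z} → InE (trackPath k) z → ¬ InE (trackPath l) z
    tracks-disjoint (just r) (just s) k≢l = Q-disj (k≢l ∘ cong just)
    tracks-disjoint (just r) nothing _ h h′ = P-avoids-e h′ r h
    tracks-disjoint nothing (just s) _ h h′ = P-avoids-e h s h′
    tracks-disjoint nothing nothing k≢l = ⊥-elim (k≢l refl)

    seg-edge-unique : ∀ σ τ {z} → InE (seg σ) z → InE (seg τ) z → σ ≡ τ
    seg-edge-unique σ τ h h′ with σ ≟ᶠ τ | ≡-dec-Maybe _≟ᶠ_ (track σ) (track τ)
    ... | yes σ≡τ | _ = σ≡τ
    ... | no _ | no k≢l = ⊥-elim (tracks-disjoint _ _ k≢l (seg⊆track σ h) (seg⊆track τ h′))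
    ... | no σ≢τ | yes k≡l with same-track σ τ σ≢τ k≡l
    ...   | inj₁ (refl , refl) = ⊥-elim (prefix-suffix-disjoint (Q zero) α α< h h′)
    ...   | inj₂ (inj₁ (refl , refl)) = ⊥-elim (prefix-suffix-disjoint (Q zero) α α< h′ h)
    ...   | inj₂ (inj₂ (inj₁ (refl , refl))) = ⊥-elim (prefix-suffix-disjoint (Q (suc zero)) β β< h h′)
    ...   | inj₂ (inj₂ (inj₂ (refl , refl))) = ⊥-elim (prefix-suffix-disjoint (Q (suc zero)) β β< h′ h)

    abstract
      edgesOf : Subset 6 → Subset m
      edgesOf p = tabulate λ z → does (any? λ σ → (σ ∈? p) ×-dec (z ∈? E (seg σ)))

      ∈edgesOf⁺ : ∀ {p} σ {z} → σ ∈ p → InE (seg σ) z → z ∈ edgesOf p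
      ∈edgesOf⁺ {p} σ {z} σ∈p h =
        ∈-tabulate⁺ _ (dec-true (any? λ τ → (τ ∈? p) ×-dec (z ∈? E (seg τ))) (σ , σ∈p , E⁺ (seg σ) h))

      ∈edgesOf⁻ : ∀ {p z} → z ∈ edgesOf p → ∃ λ σ → σ ∈ p × InE (seg σ) z
      ∈edgesOf⁻ {p} {z} h with does⇒ (any? λ τ → (τ ∈? p) ×-dec (z ∈? E (seg τ))) (∈-tabulate⁻ _ h)
      ... | σ , σ∈p , z∈ = σ , σ∈p , E⁻ (seg σ) z∈

    TP : Subset m
    TP = edgesOf ⊤

    TP-track : ∀ {z} → z ∈ TP → ∃ λ k → InE (trackPath k) z
    TP-track h = let (σ , _ , z∈σ) = ∈edgesOf⁻ {⊤} h in track σ , seg⊆track σ z∈σ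

    Q-inner-private : ∀ {r r′} → r ≢ r′ → ∀ {s s′} → 1 ≤ s → s ≤ len (Q r) → s′ ≤ suc (len (Q r′)) →
                      v (Q r) s ≢ v (Q r′) s′
    Q-inner-private {r} r≢r′ {s} 1≤s s≤ s′≤ eq with Q-meet r≢r′ (≤-trans s≤ (n≤1+n _)) s′≤ eq
    ... | inj₁ ≡x = 1+n≰n (subst (1 ≤_) (v-inj (Q r) (≤-trans s≤ (n≤1+n _)) z≤n (trans ≡x (sym (Q-start r)))) 1≤s)
    ... | inj₂ ≡y = 1+n≰n (subst (_≤ len (Q r)) (v-inj (Q r) (≤-trans s≤ (n≤1+n _)) ≤-refl (trans ≡y (sym (Q-last r)))) s≤)

    P-meets-Q-at-ends : ∀ {t} → t ≤ suc (len P) → ∀ r {s} → s ≤ suc (len (Q r)) → v P t ≡ v (Q r) s →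
                        t ≡ 0 ⊎ t ≡ suc (len P)
    P-meets-Q-at-ends {zero} _ _ _ _ = inj₁ refl
    P-meets-Q-at-ends {suc t} t≤ r s≤ eq with suc t ≤? len P
    ... | yes inner = ⊥-elim (P-avoids-v (s≤s z≤n) inner r s≤ eq)
    ... | no outer = inj₂ (≤-antisym t≤ (≰⇒> outer))

    private
      off-P-ends : ∀ r {s t} → s ≤ suc (len (Q r)) → v (Q r) s ≢ node 𝐚 → v (Q r) s ≢ node 𝐛 →
                   t ≤ suc (len P) → v (Q r) s ≢ v P t
      off-P-ends r s≤ ≢a ≢b t≤ eq with P-meets-Q-at-ends t≤ r s≤ (sym eq)
      ... | inj₁ refl = ≢a (trans eq P-start)
      ... | inj₂ refl = ≢b (trans eq P-last)

    Q-bare-at : ∀ r {s j} → s ≡ suc j → s ≤ len (Q r) → v (Q r) s ≢ node 𝐚 → v (Q r) s ≢ node 𝐛 →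
                ∀ {z w} → z ∈ TP → Joins G z (v (Q r) s) w → z ≡ e (Q r) j ⊎ z ≡ e (Q r) s
    Q-bare-at r {s} refl s≤ ≢a ≢b h jn with TP-track h
    ... | nothing , t , t≤ , refl = ⊥-elim ([ off-P-ends r (≤-trans s≤ (n≤1+n _)) ≢a ≢b (≤-trans t≤ (n≤1+n _))
                                           , off-P-ends r (≤-trans s≤ (n≤1+n _)) ≢a ≢b (s≤s t≤) ] (ends-at P t≤ jn))
    ... | just r′ , t , t≤ , refl with r ≟ᶠ r′
    ...   | no r≢r′ = ⊥-elim ([ Q-inner-private r≢r′ (s≤s z≤n) s≤ (≤-trans t≤ (n≤1+n _))
                             , Q-inner-private r≢r′ (s≤s z≤n) s≤ (s≤s t≤) ] (ends-at (Q r′) t≤ jn))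
    ...   | yes refl with ends-at (Q r) t≤ jn
    ...     | inj₁ eq = inj₂ (cong (e (Q r)) (sym (v-inj (Q r) (≤-trans s≤ (n≤1+n _)) (≤-trans t≤ (n≤1+n _)) eq)))
    ...     | inj₂ eq = inj₁ (cong (e (Q r)) (suc-injective (sym (v-inj (Q r) (≤-trans s≤ (n≤1+n _)) (s≤s t≤) eq))))

    P-bare : BarePath TP P
    P-bare {j} j< h jn with TP-track h
    ... | just r , t , t≤ , refl = ⊥-elim ([ P-avoids-v (s≤s z≤n) j< r (≤-trans t≤ (n≤1+n _))
                                           , P-avoids-v (s≤s z≤n) j< r (s≤s t≤) ] (ends-at (Q r) t≤ jn))
    ... | nothing , t , t≤ , refl with ends-at P t≤ jn
    ...   | inj₁ eq = inj₂ (cong (e P) (sym (v-inj P (≤-trans j< (n≤1+n _)) (≤-trans t≤ (n≤1+n _)) eq)))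
    ...   | inj₂ eq = inj₁ (cong (e P) (sym (suc-injective (v-inj P (≤-trans j< (n≤1+n _)) (s≤s t≤) eq))))

    private
      a-index : suc α ≤ suc (len (Q zero))
      a-index = ≤-trans α< (n≤1+n _)

      b-index : suc β ≤ suc (len (Q (suc zero)))
      b-index = ≤-trans β< (n≤1+n _)

      suffix-fits : ∀ {c j L} → suc c ≤ L → suc j ≤ L ∸ suc c → suc c + suc j ≤ L
      suffix-fits {c} c< j< = ≤-trans (+-monoʳ-≤ (suc c) j<) (≤-reflexive (m+[n∸m]≡n c<))

      suffix-inner≢ : ∀ R {c j} → suc c + suc j ≤ len R → v R (suc c + suc j) ≢ v R (suc c)
      suffix-inner≢ R {c} {j} fits eq = 1+n≢0 (+-cancelˡ-≡ (suc c) _ _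
        (trans (v-inj R (≤-trans fits (n≤1+n _)) (≤-trans (m≤m+n (suc c) (suc j)) (≤-trans fits (n≤1+n _))) eq)
          (sym (+-identityʳ _))))

      prefix-inner≢ : ∀ R {c j} → j < c → suc c ≤ suc (len R) → v R (suc j) ≢ v R (suc c)
      prefix-inner≢ R {c} {j} j<c c≤ eq = <⇒≢ (s≤s j<c) (v-inj R (≤-trans j<c (≤-trans (n≤1+n _) c≤)) c≤ eq)

    seg-bare : ∀ σ → BarePath TP (seg σ)
    seg-bare xa j< = Q-bare-at zero refl inner (prefix-inner≢ (Q zero) j< a-index)
                       (Q-inner-private (λ ()) (s≤s z≤n) inner b-index)
      where inner = ≤-trans j< (≤-trans (n≤1+n _) α<)
    seg-bare ay {j} j< = Q-bare-at zero (+-suc (suc α) j) inner (suffix-inner≢ (Q zero) inner)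
                           (Q-inner-private (λ ()) (s≤s z≤n) inner b-index)
      where inner = suffix-fits α< j<
    seg-bare xb j< = Q-bare-at (suc zero) refl inner (Q-inner-private (λ ()) (s≤s z≤n) inner a-index)
                       (prefix-inner≢ (Q (suc zero)) j< b-index)
      where inner = ≤-trans j< (≤-trans (n≤1+n _) β<)
    seg-bare by {j} j< = Q-bare-at (suc zero) (+-suc (suc β) j) inner
                           (Q-inner-private (λ ()) (s≤s z≤n) inner a-index) (suffix-inner≢ (Q (suc zero)) inner)
      where inner = suffix-fits β< j<
    seg-bare xy j< = Q-bare-at (suc (suc zero)) refl j< (Q-inner-private (λ ()) (s≤s z≤n) j< a-index)
                       (Q-inner-private (λ ()) (s≤s z≤n) j< b-index)
    seg-bare ab = P-bare

    private
      not-an-edge-of : ∀ σ τ → σ ≢ τ → ∀ {j} → suc j ≤ len (seg σ) →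
                       ∀ {z w} → InE (seg τ) z → ¬ Joins G z (v (seg σ) (suc j)) w
      not-an-edge-of σ τ σ≢τ {j} j< z∈τ jn with seg-bare σ j< (∈edgesOf⁺ τ ∈⊤ z∈τ) jn
      ... | inj₁ refl = σ≢τ (seg-edge-unique σ τ (j , ≤-trans (n≤1+n j) j< , refl) z∈τ)
      ... | inj₂ refl = σ≢τ (seg-edge-unique σ τ (suc j , j< , refl) z∈τ)

    inner-private : ∀ σ τ → σ ≢ τ → ∀ {j} → suc j ≤ len (seg σ) → ¬ OnR (seg τ) (v (seg σ) (suc j))
    inner-private σ τ σ≢τ j< (t , t≤ , eq) with t ≤? len (seg τ)
    ... | yes t≤len = not-an-edge-of σ τ σ≢τ j< (t , t≤len , refl)
                        (subst (λ u → Joins G (e (seg τ) t) u (v (seg τ) (suc t))) eq (link (seg τ) t≤len))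
    ... | no t≰len = not-an-edge-of σ τ σ≢τ j< (len (seg τ) , ≤-refl , refl)
                       (subst (λ u → Joins G (e (seg τ) (len (seg τ))) u (v (seg τ) (len (seg τ))))
                              (trans (cong (v (seg τ)) (sym (≤-antisym t≤ (≰⇒> t≰len)))) eq)
                              (joins-sym (link (seg τ) ≤-refl)))

    private
      at-an-end : ∀ σ τ → σ ≢ τ → ∀ {u} → OnR (seg σ) u → OnR (seg τ) u → ∃ λ ν → u ≡ node ν × Ends ν σ
      at-an-end σ τ σ≢τ (zero , _ , refl) _ = tail σ , seg-start σ , inj₁ refl
      at-an-end σ τ σ≢τ (suc j , j≤ , refl) on-τ with suc j ≤? len (seg σ)
      ... | yes inner = ⊥-elim (inner-private σ τ σ≢τ inner on-τ)
      ... | no outer = head σ , trans (cong (v (seg σ)) (≤-antisym j≤ (≰⇒> outer))) (seg-last σ) , inj₂ refl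

    meet : ∀ σ τ → σ ≢ τ → ∀ {u} → OnR (seg σ) u → OnR (seg τ) u → ∃ λ ν → u ≡ node ν × Ends ν σ × Ends ν τ
    meet σ τ σ≢τ on-σ on-τ with at-an-end σ τ σ≢τ on-σ on-τ | at-an-end τ σ (σ≢τ ∘ sym) on-τ on-σ
    ... | ν , u≡ , ends-σ | μ , u≡′ , ends-τ with node-injective {ν} {μ} (trans (sym u≡) u≡′)
    ...   | refl = ν , u≡ , ends-σ , ends-τ

    node-on : ∀ {ν σ} → Ends ν σ → OnR (seg σ) (node ν)
    node-on {σ = σ} (inj₁ refl) = 0 , z≤n , seg-start σ
    node-on {σ = σ} (inj₂ refl) = suc (len (seg σ)) , ≤-refl , seg-last σ

    end-edge : Node → Segment → Fin m
    end-edge ν σ = e (seg σ) (if does (ν ≟ᶠ tail σ) then 0 else len (seg σ))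

    end-edge-tail : ∀ σ → end-edge (tail σ) σ ≡ e (seg σ) 0
    end-edge-tail σ = cong (λ c → e (seg σ) (if c then 0 else len (seg σ))) (dec-true (tail σ ≟ᶠ tail σ) refl)

    end-edge-head : ∀ σ → end-edge (head σ) σ ≡ e (seg σ) (len (seg σ))
    end-edge-head σ = cong (λ c → e (seg σ) (if c then 0 else len (seg σ)))
                           (dec-false (head σ ≟ᶠ tail σ) (tail≢head σ ∘ sym))

    edge-at-node : ∀ ν {z w} → z ∈ TP → Joins G z (node ν) w → ∃ λ τ → Ends ν τ × z ≡ end-edge ν τ
    edge-at-node ν h jn with ∈edgesOf⁻ {⊤} h
    ... | τ , _ , t , t≤ , refl = τ , ends-τ , at-end ends-τ (ends-at (seg τ) t≤ jn)
      where
      on-τ : OnR (seg τ) (node ν)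
      on-τ = [ (λ eq → t , ≤-trans t≤ (n≤1+n _) , sym eq) , (λ eq → suc t , s≤s t≤ , sym eq) ] (ends-at (seg τ) t≤ jn)
      ends-τ : Ends ν τ
      ends-τ with another-segment-at ν τ
      ... | σ , ends-σ , σ≢τ with meet σ τ σ≢τ (node-on ends-σ) on-τ
      ...   | μ , ν≡μ , _ , ends-μ with node-injective {ν} {μ} ν≡μ
      ...     | refl = ends-μ
      at-end : Ends ν τ → node ν ≡ v (seg τ) t ⊎ node ν ≡ v (seg τ) (suc t) → e (seg τ) t ≡ end-edge ν τ
      at-end (inj₁ refl) (inj₁ eq) =
        trans (cong (e (seg τ)) (v-inj (seg τ) (≤-trans t≤ (n≤1+n _)) z≤n (trans (sym eq) (sym (seg-start τ)))))
              (sym (end-edge-tail τ))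
      at-end (inj₁ refl) (inj₂ eq) = ⊥-elim (1+n≢0 (v-inj (seg τ) (s≤s t≤) z≤n (trans (sym eq) (sym (seg-start τ)))))
      at-end (inj₂ refl) (inj₁ eq) =
        ⊥-elim (1+n≰n (subst (_≤ len (seg τ)) (sym (v-inj (seg τ) ≤-refl (≤-trans t≤ (n≤1+n _)) (trans (seg-last τ) eq))) t≤))
      at-end (inj₂ refl) (inj₂ eq) =
        trans (cong (e (seg τ)) (suc-injective (v-inj (seg τ) (s≤s t≤) ≤-refl (trans (sym eq) (sym (seg-last τ))))))
              (sym (end-edge-head τ))

    end-edge-on : ∀ {ν τ} → Ends ν τ → InE (seg τ) (end-edge ν τ)
    end-edge-on {τ = τ} (inj₁ refl) = 0 , z≤n , sym (end-edge-tail τ)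
    end-edge-on {τ = τ} (inj₂ refl) = len (seg τ) , ≤-refl , sym (end-edge-head τ)

    end-edge-leaves : ∀ {ν σ} → Ends ν σ → ∃ λ w → Joins G (end-edge ν σ) (node ν) w × node ν ≢ w
    end-edge-leaves {σ = σ} (inj₁ refl) =
      v (seg σ) 1 , subst₂ (λ z u → Joins G z u (v (seg σ) 1)) (sym (end-edge-tail σ)) (seg-start σ) (link (seg σ) z≤n) ,
      λ eq → 0≢1+n (v-inj (seg σ) z≤n (s≤s z≤n) (trans (seg-start σ) eq))
    end-edge-leaves {σ = σ} (inj₂ refl) =
      v (seg σ) (len (seg σ)) ,
      subst₂ (λ z u → Joins G z u (v (seg σ) (len (seg σ)))) (sym (end-edge-head σ)) (seg-last σ) (joins-sym (link (seg σ) ≤-refl)) ,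
      λ eq → 1+n≢n (v-inj (seg σ) ≤-refl (n≤1+n _) (trans (seg-last σ) eq))

    module _ {K : Subset m} (K-closed : Closed K) (K⊆TP : K ⊆ TP) where

      private
        first-in-K : Segment → Bool
        first-in-K σ = does (e (seg σ) 0 ∈? K)

      segmentsIn : Subset 6
      segmentsIn = tabulate first-in-K

      whole-segment : ∀ {σ t} → σ ∈ segmentsIn → t ≤ len (seg σ) → e (seg σ) t ∈ K
      whole-segment {σ} σ∈ t≤ = all-or-none K-closed K⊆TP (seg σ) (seg-bare σ) z≤n t≤
        (does⇒ (e (seg σ) 0 ∈? K) (∈-tabulate⁻ first-in-K σ∈))

      segment-meeting : ∀ {σ z} → InE (seg σ) z → z ∈ K → σ ∈ segmentsIn
      segment-meeting {σ} (t , t≤ , refl) z∈K =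
        ∈-tabulate⁺ first-in-K (dec-true (e (seg σ) 0 ∈? K) (all-or-none K-closed K⊆TP (seg σ) (seg-bare σ) t≤ z≤n z∈K))

      closed-is-union : K ≡ edgesOf segmentsIn
      closed-is-union = ⊆-antisym
        (λ z∈K → let (σ , _ , z∈σ) = ∈edgesOf⁻ {⊤} (K⊆TP z∈K) in ∈edgesOf⁺ σ (segment-meeting z∈σ z∈K) z∈σ)
        (λ h → let (σ , σ∈ , t , t≤ , eq) = ∈edgesOf⁻ h in subst (_∈ K) eq (whole-segment σ∈ t≤))

      segmentsIn-nonempty : ∀ {z} → z ∈ K → Nonempty segmentsIn
      segmentsIn-nonempty z∈K = let (σ , _ , z∈σ) = ∈edgesOf⁻ {⊤} (K⊆TP z∈K) in σ , segment-meeting z∈σ z∈K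

      end-edge-in : ∀ {ν σ} → Ends ν σ → σ ∈ segmentsIn → end-edge ν σ ∈ K
      end-edge-in ends σ∈ = let (t , t≤ , eq) = end-edge-on ends in subst (_∈ K) eq (whole-segment σ∈ t≤)

      segmentsIn-leafless : Leafless segmentsIn
      segmentsIn-leafless ν σ σ∈ ends-σ with end-edge-leaves ends-σ
      ... | w , jn , ν≢w with K-closed (end-edge-in ends-σ σ∈) jn
      ...   | inj₁ ν≡w = ⊥-elim (ν≢w ν≡w)
      ...   | inj₂ (x′ , x′∈K , x′≢ , w′ , j′) with edge-at-node ν (K⊆TP x′∈K) j′
      ...     | τ , ends-τ , refl = τ , segment-meeting (end-edge-on ends-τ) x′∈K , ends-τ , λ { refl → x′≢ refl }

    from : ∀ {ν σ} → Ends ν σ → RawPath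
    from {σ = σ} (inj₁ _) = seg σ
    from {σ = σ} (inj₂ _) = reverse (seg σ)

    from-start : ∀ {ν σ} (end : Ends ν σ) → v (from end) 0 ≡ node ν
    from-start {σ = σ} (inj₁ refl) = seg-start σ
    from-start {σ = σ} (inj₂ refl) = seg-last σ

    from-last : ∀ {ν σ} (end : Ends ν σ) → last (from end) ≡ node (other ν σ)
    from-last {σ = σ} (inj₁ refl) = trans (seg-last σ) (cong node (sym (other-tail σ)))
    from-last {σ = σ} (inj₂ refl) = trans (reverse-last (seg σ)) (trans (seg-start σ) (cong node (sym (other-head σ))))

    from-E⁻ : ∀ {ν σ} (end : Ends ν σ) {z} → InE (from end) z → InE (seg σ) z
    from-E⁻ (inj₁ _) h = h
    from-E⁻ {σ = σ} (inj₂ _) h = reverseE⁻ (seg σ) h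

    from-E⁺ : ∀ {ν σ} (end : Ends ν σ) {z} → InE (seg σ) z → InE (from end) z
    from-E⁺ (inj₁ _) h = h
    from-E⁺ {σ = σ} (inj₂ _) h = reverseE⁺ (seg σ) h

    from-On⁻ : ∀ {ν σ} (end : Ends ν σ) {u} → OnR (from end) u → OnR (seg σ) u
    from-On⁻ (inj₁ _) h = h
    from-On⁻ {σ = σ} (inj₂ _) h = reverseOn⁻ (seg σ) h

    module Detour (ρ : Segment) (k : Fin 2) where
      private
        fact = plan-detour ρ k
        out = proj₁ fact
        back = proj₁ (proj₂ fact)
        distinct = proj₁ (proj₂ (proj₂ fact))
        only-mid = proj₁ (proj₂ (proj₂ (proj₂ fact)))

        junction : last (from out) ≡ v (from back) 0
        junction = trans (from-last out) (sym (from-start back))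

        v-disj : ∀ {s t} → s ≤ suc (len (from out)) → t ≤ suc (len (from back)) →
                 v (from out) s ≡ v (from back) t → t ≡ 0
        v-disj {s} {t} s≤ t≤ eq with meet (first ρ k) (second ρ k) distinct
                                           (from-On⁻ out (s , s≤ , refl)) (from-On⁻ back (t , t≤ , sym eq))
        ... | μ , u≡ , in-out , in-back = v-inj (from back) t≤ z≤n
          (trans (sym eq) (trans u≡ (trans (cong node (only-mid μ in-out in-back)) (sym (from-start back)))))

        e-disj : ∀ {s t} → s ≤ len (from out) → t ≤ len (from back) → e (from out) s ≢ e (from back) t
        e-disj s≤ t≤ eq = distinct (seg-edge-unique _ _ (from-E⁻ out (_ , s≤ , refl)) (from-E⁻ back (_ , t≤ , sym eq)))

      open Concat (from out) (from back) junction v-disj e-disj public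

      detour-start : v concat 0 ≡ node (hub ρ)
      detour-start = trans concat-start (from-start out)

      detour-last : last concat ≡ node (rim ρ)
      detour-last = trans concat-last (trans (from-last back) (cong node (proj₂ (proj₂ (proj₂ (proj₂ fact))))))

      detour-E⁻ : ∀ {z} → InE concat z → InE (seg (first ρ k)) z ⊎ InE (seg (second ρ k)) z
      detour-E⁻ h = Sum.map (from-E⁻ out) (from-E⁻ back) (concatE⁻ h)

      detour-E⁺ : ∀ {z} → InE (seg (first ρ k)) z ⊎ InE (seg (second ρ k)) z → InE concat z
      detour-E⁺ h = concatE⁺ (Sum.map (from-E⁺ out) (from-E⁺ back) h)

      detour-On⁻ : ∀ {u} → OnR concat u → OnR (seg (first ρ k)) u ⊎ OnR (seg (second ρ k)) u
      detour-On⁻ h = Sum.map (from-On⁻ out) (from-On⁻ back) (concatOn⁻ h)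

    plan-path : Segment → Fin 3 → RawPath
    plan-path ρ zero = from (proj₁ (plan-direct ρ))
    plan-path ρ (suc k) = Detour.concat ρ k

    plan-path-start : ∀ ρ i → v (plan-path ρ i) 0 ≡ node (hub ρ)
    plan-path-start ρ zero = from-start (proj₁ (plan-direct ρ))
    plan-path-start ρ (suc k) = Detour.detour-start ρ k

    plan-path-last : ∀ ρ i → last (plan-path ρ i) ≡ node (rim ρ)
    plan-path-last ρ zero = from-last (proj₁ (plan-direct ρ))
    plan-path-last ρ (suc k) = Detour.detour-last ρ k

    private
      ∈route-direct : ∀ ρ → direct ρ ∈ route ρ zero
      ∈route-direct ρ = x∈⁅x⁆ (direct ρ)

      ∈route-detour : ∀ ρ k {σ} → σ ≡ first ρ k ⊎ σ ≡ second ρ k → σ ∈ route ρ (suc k)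
      ∈route-detour ρ k (inj₁ refl) = p⊆p∪q _ (x∈⁅x⁆ (first ρ k))
      ∈route-detour ρ k (inj₂ refl) = q⊆p∪q _ _ (x∈⁅x⁆ (second ρ k))

      route-detour⁻ : ∀ ρ k {σ} → σ ∈ route ρ (suc k) → σ ≡ first ρ k ⊎ σ ≡ second ρ k
      route-detour⁻ ρ k h = Sum.map (x∈⁅y⁆⇒x≡y _) (x∈⁅y⁆⇒x≡y _) (x∈p∪q⁻ _ _ h)

    plan-path-On⁻ : ∀ ρ i {u} → OnR (plan-path ρ i) u → ∃ λ σ → σ ∈ route ρ i × OnR (seg σ) u
    plan-path-On⁻ ρ zero h = direct ρ , ∈route-direct ρ , from-On⁻ (proj₁ (plan-direct ρ)) h
    plan-path-On⁻ ρ (suc k) h with Detour.detour-On⁻ ρ k h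
    ... | inj₁ on = first ρ k , ∈route-detour ρ k (inj₁ refl) , on
    ... | inj₂ on = second ρ k , ∈route-detour ρ k (inj₂ refl) , on

    plan-path-E⁻ : ∀ ρ i {z} → InE (plan-path ρ i) z → ∃ λ σ → σ ∈ route ρ i × InE (seg σ) z
    plan-path-E⁻ ρ zero h = direct ρ , ∈route-direct ρ , from-E⁻ (proj₁ (plan-direct ρ)) h
    plan-path-E⁻ ρ (suc k) h with Detour.detour-E⁻ ρ k h
    ... | inj₁ z∈ = first ρ k , ∈route-detour ρ k (inj₁ refl) , z∈
    ... | inj₂ z∈ = second ρ k , ∈route-detour ρ k (inj₂ refl) , z∈

    plan-path-E⁺ : ∀ ρ i {σ z} → σ ∈ route ρ i → InE (seg σ) z → InE (plan-path ρ i) z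
    plan-path-E⁺ ρ zero σ∈ z∈ rewrite x∈⁅y⁆⇒x≡y _ σ∈ = from-E⁺ (proj₁ (plan-direct ρ)) z∈
    plan-path-E⁺ ρ (suc k) σ∈ z∈ with route-detour⁻ ρ k σ∈
    ... | inj₁ refl = Detour.detour-E⁺ ρ k (inj₁ z∈)
    ... | inj₂ refl = Detour.detour-E⁺ ρ k (inj₂ z∈)

    theta-without : Segment → Theta G
    theta-without ρ = theta-of (λ eq → proj₂ (plan-direct ρ) (node-injective eq)) (plan-path ρ)
      (plan-path-start ρ) (plan-path-last ρ) meets disjoint
      where
      meets : ∀ i j → i ≢ j → ∀ {u} → OnR (plan-path ρ i) u → OnR (plan-path ρ j) u →
              u ≡ node (hub ρ) ⊎ u ≡ node (rim ρ)
      meets i j i≢j on-i on-j with plan-path-On⁻ ρ i on-i | plan-path-On⁻ ρ j on-j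
      ... | σ , σ∈ , on-σ | τ , τ∈ , on-τ with plan-crossing ρ i j i≢j σ τ σ∈ τ∈
      ...   | σ≢τ , hub-or-rim with meet σ τ σ≢τ on-σ on-τ
      ...     | μ , u≡ , ends-σ , ends-τ = Sum.map (λ eq → trans u≡ (cong node eq)) (λ eq → trans u≡ (cong node eq))
                                              (hub-or-rim μ ends-σ ends-τ)
      disjoint : ∀ i j → i ≢ j → ∀ {z} → InE (plan-path ρ i) z → ¬ InE (plan-path ρ j) z
      disjoint i j i≢j h h′ with plan-path-E⁻ ρ i h | plan-path-E⁻ ρ j h′
      ... | σ , σ∈ , z∈σ | τ , τ∈ , z∈τ = proj₁ (plan-crossing ρ i j i≢j σ τ σ∈ τ∈) (seg-edge-unique σ τ z∈σ z∈τ)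

    edgesOf-∪ : ∀ p q → edgesOf (p ∪ q) ≡ edgesOf p ∪ edgesOf q
    edgesOf-∪ p q = ⊆-antisym
      (λ h → let (σ , σ∈ , z∈) = ∈edgesOf⁻ h in
             x∈p∪q⁺ (Sum.map (λ σ∈p → ∈edgesOf⁺ σ σ∈p z∈) (λ σ∈q → ∈edgesOf⁺ σ σ∈q z∈) (x∈p∪q⁻ p q σ∈)))
      (λ h → [ (λ h₁ → let (σ , σ∈ , z∈) = ∈edgesOf⁻ h₁ in ∈edgesOf⁺ σ (p⊆p∪q q σ∈) z∈)
             , (λ h₂ → let (σ , σ∈ , z∈) = ∈edgesOf⁻ h₂ in ∈edgesOf⁺ σ (q⊆p∪q p q σ∈) z∈) ] (x∈p∪q⁻ _ _ h))

    plan-path-edges : ∀ ρ i → E (plan-path ρ i) ≡ edgesOf (route ρ i)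
    plan-path-edges ρ i = ⊆-antisym
      (λ h → let (σ , σ∈ , z∈) = plan-path-E⁻ ρ i (E⁻ (plan-path ρ i) h) in ∈edgesOf⁺ σ σ∈ z∈)
      (λ h → let (σ , σ∈ , z∈) = ∈edgesOf⁻ h in E⁺ (plan-path ρ i) (plan-path-E⁺ ρ i σ∈ z∈))

    theta-without-cycle : ∀ ρ i j → Theta.cyc (theta-without ρ) i j ≡ edgesOf (route ρ i ∪ route ρ j)
    theta-without-cycle ρ i j =
      trans (cong₂ _∪_ (plan-path-edges ρ i) (plan-path-edges ρ j)) (sym (edgesOf-∪ (route ρ i) (route ρ j)))

    private
      plan-path-avoids : ∀ ρ i {z} → z ∈ E (plan-path ρ i) → z ∈ TP × z ≢ e (seg ρ) 0
      plan-path-avoids ρ i h with plan-path-E⁻ ρ i (E⁻ (plan-path ρ i) h)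
      ... | σ , σ∈ , z∈σ = ∈edgesOf⁺ σ ∈⊤ z∈σ ,
        λ { refl → plan-avoids ρ i (subst (_∈ route ρ i) (seg-edge-unique σ ρ z∈σ (0 , z≤n , refl)) σ∈) }

    theta-without-avoids : ∀ ρ {z} → z ∈ Theta.edges (theta-without ρ) → z ∈ TP × z ≢ e (seg ρ) 0
    theta-without-avoids ρ h =
      [ plan-path-avoids ρ zero , [ plan-path-avoids ρ (suc zero) , plan-path-avoids ρ (suc (suc zero)) ] ∘ x∈p∪q⁻ _ _ ]
      (x∈p∪q⁻ _ _ h)

    module _ (φ : Fin 4 → Segment) (φ-injective : Injective _≡_ _≡_ φ)
             (cycle-for : ∀ r s → r ≢ s → ∃ λ q → LeaflessAvoiding (φ r) (φ s) q × balanced Ω (edgesOf q) ≡ false)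
             where

      ψ : Fin 4 → Fin m
      ψ r = e (seg (φ r)) 0

      ψ-injective : Injective _≡_ _≡_ ψ
      ψ-injective {r} {s} eq = φ-injective (seg-edge-unique (φ r) (φ s) (0 , z≤n , refl) (0 , z≤n , sym eq))

      Avoids : Subset m → Fin 4 → Set
      Avoids Y r = ∀ {z} → z ∈ Y → z ∈ TP × z ≢ ψ r

      pair-independent : ∀ {r s} → r ≢ s → ∀ {Y} → Avoids Y r → Avoids Y s → FrameIndep Ω Y
      pair-independent {r} {s} r≢s {Y} avoids-r avoids-s with cycle-for r s r≢s
      ... | q , q-cycle , q-unbalanced = independent-if-unique-closed Y (edgesOf q) q-unbalanced only-q
        where
        only-q : ∀ K → Closed K → K ⊆ Y → ∀ {z} → z ∈ K → K ≡ edgesOf q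
        only-q K K-closed K⊆Y z∈K = trans (closed-is-union K-closed K⊆TP)
          (cong edgesOf (leaflessAvoiding-unique (r≢s ∘ φ-injective) K-pattern q-cycle))
          where
          K⊆TP : K ⊆ TP
          K⊆TP = proj₁ ∘ avoids-r ∘ K⊆Y
          missing : ∀ {t} → Avoids Y t → φ t ∉ segmentsIn K-closed K⊆TP
          missing avoids φt∈ = proj₂ (avoids (K⊆Y (whole-segment K-closed K⊆TP φt∈ z≤n))) refl
          K-pattern : LeaflessAvoiding (φ r) (φ s) (segmentsIn K-closed K⊆TP)
          K-pattern = segmentsIn-leafless K-closed K⊆TP , segmentsIn-nonempty K-closed K⊆TP z∈K ,
                      missing avoids-r , missing avoids-s

      all-but-one-dependent : ∀ r {Y} → (∀ {z} → z ∈ TP → z ≢ ψ r → z ∈ Y) → ¬ FrameIndep Ω Y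
      all-but-one-dependent r {Y} contains indep with theta-contains-circuit (theta-without (φ r))
      ... | S , circuit , S⊆θ = indep S circuit λ z∈S → let (z∈TP , z≢) = theta-without-avoids (φ r) (S⊆θ z∈S) in contains z∈TP z≢

      private
        InB : Fin m → Set
        InB z = z ∈ TP × ∀ r → z ≢ ψ r

        InB? : ∀ z → Dec (InB z)
        InB? z = (z ∈? TP) ×-dec all? λ r → ¬? (z ≟ᶠ ψ r)

      B : Subset m
      B = tabulate (does ∘ InB?)

      B⁻ : ∀ {z} → z ∈ B → InB z
      B⁻ {z} h = does⇒ (InB? z) (∈-tabulate⁻ (does ∘ InB?) h)

      B⁺ : ∀ {z} → InB z → z ∈ B
      B⁺ {z} h = ∈-tabulate⁺ (does ∘ InB?) (dec-true (InB? z) h)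

      kept-or-contracted-avoids : ∀ {I r} → r ∉ I → Avoids (imageSub ψ I ∪ B) r
      kept-or-contracted-avoids {I} {r} r∉I h with x∈p∪q⁻ (imageSub ψ I) B h
      ... | inj₂ z∈B = proj₁ (B⁻ z∈B) , proj₂ (B⁻ z∈B) r
      ... | inj₁ z∈ψI with ∈-imageSub⁻ ψ z∈ψI
      ...   | i , i∈I , refl = ∈edgesOf⁺ (φ i) ∈⊤ (0 , z≤n , refl) , λ eq → r∉I (subst (_∈ I) (ψ-injective eq) i∈I)

      kept-or-contracted-covers : ∀ {I r} → (∀ i → i ≢ r → i ∈ I) → ∀ {z} → z ∈ TP → z ≢ ψ r → z ∈ imageSub ψ I ∪ B
      kept-or-contracted-covers {I} {r} others∈I {z} z∈TP z≢ψr with any? (λ i → z ≟ᶠ ψ i)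
      ... | yes (i , refl) = x∈p∪q⁺ (inj₁ (∈-imageSub⁺ ψ (others∈I i λ { refl → z≢ψr refl })))
      ... | no not-kept = x∈p∪q⁺ (inj₂ (B⁺ (z∈TP , λ i eq → not-kept (i , eq))))

      u₂₄-minor : IsMinorOf (UniformIndep 2 4) (FrameIndep Ω)
      u₂₄-minor = ψ , ψ-injective , B , B , (λ r ψr∈B → proj₂ (B⁻ ψr∈B) r refl) , (λ h → h) ,
                  pair-independent {zero} {suc zero} (λ ()) (contracted-avoids zero) (contracted-avoids (suc zero)) ,
                  (λ _ z∈B z∉B → ⊥-elim (z∉B z∈B)) , rank-two
        where
        contracted-avoids : ∀ r → Avoids B r
        contracted-avoids r z∈B = proj₁ (B⁻ z∈B) , proj₂ (B⁻ z∈B) r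
        rank-two : ∀ I → UniformIndep 2 4 I ⇔ FrameIndep Ω (imageSub ψ I ∪ B)
        rank-two I with ∣ I ∣ ≤? 2
        ... | yes small = let (r , s , r≢s , r∉I , s∉I) = two-outside I small in
          mk⇔ (λ _ → pair-independent r≢s (kept-or-contracted-avoids r∉I) (kept-or-contracted-avoids s∉I)) (λ _ → small)
        ... | no large = let (r , others∈I) = all-but-one-inside I large in
          mk⇔ (λ small → ⊥-elim (large small)) (λ indep → ⊥-elim (all-but-one-dependent r (kept-or-contracted-covers others∈I) indep))

    track-covered : ∀ k {z} → InE (trackPath k) z → ∃ λ σ → track σ ≡ k × InE (seg σ) z
    track-covered (just zero) h =
      [ (λ h′ → xa , refl , h′) , (λ h′ → ay , refl , h′) ] (prefix-or-suffix (Q zero) α α< h)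
    track-covered (just (suc zero)) h =
      [ (λ h′ → xb , refl , h′) , (λ h′ → by , refl , h′) ] (prefix-or-suffix (Q (suc zero)) β β< h)
    track-covered (just (suc (suc zero))) h = xy , refl , h
    track-covered nothing h = ab , refl , h

    along-edges : ∀ r → E (Q r) ≡ edgesOf (along r)
    along-edges r = ⊆-antisym
      (λ h → let (σ , on-r , z∈) = track-covered (just r) (E⁻ (Q r) h) in ∈edgesOf⁺ σ (∈along⁺ on-r) z∈)
      (λ h → let (σ , σ∈ , z∈) = ∈edgesOf⁻ h in
             E⁺ (Q r) (subst (λ k → InE (trackPath k) _) (∈along⁻ σ∈) (seg⊆track σ z∈)))

    module _ (contrabalanced : ∀ r s → r ≢ s → balanced Ω (edgesOf (along r ∪ along s)) ≡ false) where
      private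
        candidate-unbalanced : ∀ c → balanced Ω (edgesOf (triangle c)) ≡ false → ∀ k → balanced Ω (edgesOf (candidate c k)) ≡ false
        candidate-unbalanced c triangle-unbalanced zero = triangle-unbalanced
        candidate-unbalanced c _ (suc zero) = contrabalanced (suc zero) (suc (suc zero)) (λ ())
        candidate-unbalanced c _ (suc (suc zero)) = contrabalanced zero (suc (suc zero)) (λ ())
        candidate-unbalanced c _ (suc (suc (suc zero))) = contrabalanced zero (suc zero) (λ ())

        minor-at : ∀ c → balanced Ω (edgesOf (triangle c)) ≡ false → IsMinorOf (UniformIndep 2 4) (FrameIndep Ω)
        minor-at c triangle-unbalanced = u₂₄-minor (kept c) (kept-injective c _ _) λ r s r≢s →
          let (k , k-cycle) = kept-cycles c r s r≢s in
          candidate c k , k-cycle , candidate-unbalanced c triangle-unbalanced k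

      -- If both triangles through ab were balanced, K₄ minus xy would be a theta
      -- with exactly two balanced cycles.
      u₂₄-minor-of-contrabalanced : IsMinorOf (UniformIndep 2 4) (FrameIndep Ω)
      u₂₄-minor-of-contrabalanced
        with balanced Ω (edgesOf (triangle zero)) in b₀ | balanced Ω (edgesOf (triangle (suc zero))) in b₁
      ... | false | _ = minor-at zero b₀
      ... | true | false = minor-at (suc zero) b₁
      ... | true | true = ⊥-elim (theta-prop Ω (theta-without xy) two-balanced)
        where
        count3-two : ∀ {a b c} → a ≡ true → b ≡ true → c ≡ false → count3 a b c ≡ 2
        count3-two refl refl refl = refl
        as-pattern : ∀ i j {p} → route xy i ∪ route xy j ≡ p →
                     balanced Ω (Theta.cyc (theta-without xy) i j) ≡ balanced Ω (edgesOf p)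
        as-pattern i j eq = cong (balanced Ω) (trans (theta-without-cycle xy i j) (cong edgesOf eq))
        two-balanced : count3 (balanced Ω (Theta.cyc (theta-without xy) zero (suc zero)))
                              (balanced Ω (Theta.cyc (theta-without xy) zero (suc (suc zero))))
                              (balanced Ω (Theta.cyc (theta-without xy) (suc zero) (suc (suc zero)))) ≡ 2
        two-balanced = count3-two (trans (as-pattern zero (suc zero) refl) b₁)
                                  (trans (as-pattern zero (suc (suc zero)) refl) b₀)
                                  (trans (as-pattern (suc zero) (suc (suc zero)) refl) (contrabalanced zero (suc zero) (λ ())))

  inner-index : (R : Path G) → ∀ {u} → Path.Internal R u →
                ∃ λ c → suc c ≤ Path.len R × v (fromPath R) (suc c) ≡ u
  inner-index R ((i , refl) , ≢start , ≢end) with toℕ i in eq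
  ... | zero = ⊥-elim (≢start (cong (Path.vtx R) (toℕ-injective eq)))
  ... | suc c with suc c ≤? Path.len R
  ...   | yes inner = c , inner , trans (cong (v (fromPath R)) (sym eq)) (fromPath-v R i)
  ...   | no outer = ⊥-elim (≢end (cong (Path.vtx R) (toℕ-injective (trans eq (trans
            (≤-antisym (subst (_≤ suc (Path.len R)) eq (toℕ≤pred[n] i)) (≰⇒> outer)) (sym (toℕ-fromℕ (suc (Path.len R)))))))))

  module FromShortcut (T : Theta G) (P : Path G) (shortcut : Shortcut Ω T P) where
    open Theta T
    private
      i = proj₁ (proj₁ shortcut)
      j = proj₁ (proj₂ (proj₁ shortcut))
      π = arrange i j

      π-injective : ∀ {r s} → r ≢ s → π r ≢ π s
      π-injective = arrange-injective i j (proj₁ (proj₂ (proj₂ (proj₁ shortcut)))) _ _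

      a = inner-index (Q i) (proj₁ (proj₂ (proj₂ (proj₂ (proj₁ shortcut)))))
      b = inner-index (Q j) (proj₂ (proj₂ (proj₂ (proj₂ (proj₁ shortcut)))))

      edge-of : ∀ r {z} → InE (fromPath (Q (π r))) z → z ∈ pathEdges (Q (π r))
      edge-of r h = subst (_ ∈_) (fromPath-E (Q (π r))) (E⁺ (fromPath (Q (π r))) h)

      on-path : ∀ r {t} → t ≤ suc (len (fromPath (Q (π r)))) → Path.OnPath (Q (π r)) (v (fromPath (Q (π r))) t)
      on-path r t≤ = fromPath-On⁺ (Q (π r)) (_ , t≤ , refl)

      meet′ : ∀ {r s} → r ≢ s → ∀ {t t′} → t ≤ suc (len (fromPath (Q (π r)))) → t′ ≤ suc (len (fromPath (Q (π s)))) →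
              v (fromPath (Q (π r))) t ≡ v (fromPath (Q (π s))) t′ →
              v (fromPath (Q (π r))) t ≡ x ⊎ v (fromPath (Q (π r))) t ≡ y
      meet′ {r} {s} r≢s {t} t≤ t′≤ eq with v (fromPath (Q (π r))) t ≟ᶠ x | v (fromPath (Q (π r))) t ≟ᶠ y
      ... | yes ≡x | _ = inj₁ ≡x
      ... | no _ | yes ≡y = inj₂ ≡y
      ... | no ≢x | no ≢y = ⊥-elim (int-disj (π r) (π s) (π-injective r≢s) _
              (on-path r t≤ , (λ eq′ → ≢x (trans eq′ (Q-start (π r)))) , (λ eq′ → ≢y (trans eq′ (Q-end (π r)))))
              (subst (Path.OnPath (Q (π s))) (sym eq) (on-path s t′≤) ,
               (λ eq′ → ≢x (trans eq′ (Q-start (π s)))) , (λ eq′ → ≢y (trans eq′ (Q-end (π s))))))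

      P-inner : ∀ {t} → 1 ≤ t → t ≤ len (fromPath P) → Path.Internal P (v (fromPath P) t)
      P-inner 1≤t t≤ = fromPath-On⁺ P (_ , ≤-trans t≤ (n≤1+n _) , refl) ,
        (λ eq → 1+n≰n (subst (1 ≤_) (v-inj (fromPath P) (≤-trans t≤ (n≤1+n _)) z≤n (trans eq (sym (fromPath-start P)))) 1≤t)) ,
        (λ eq → 1+n≰n (subst (_≤ len (fromPath P)) (v-inj (fromPath P) (≤-trans t≤ (n≤1+n _)) ≤-refl
                                                           (trans eq (sym (fromPath-end P)))) t≤))

    shortcut-theta : ShortcutTheta
    shortcut-theta = record
      { x = x ; y = y ; x≢y = x≢y
      ; Q = λ r → fromPath (Q (π r))
      ; Q-start = λ r → trans (fromPath-start (Q (π r))) (Q-start (π r))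
      ; Q-last = λ r → trans (fromPath-end (Q (π r))) (Q-end (π r))
      ; Q-meet = meet′
      ; Q-disj = λ {r} {s} r≢s {z} h h′ → edge-disj (π r) (π s) (π-injective r≢s) z (edge-of r h) (edge-of s h′)
      ; P = fromPath P
      ; α = proj₁ a
      ; β = proj₁ b
      ; α< = proj₁ (proj₂ a)
      ; β< = proj₁ (proj₂ b)
      ; P-start = trans (fromPath-start P) (sym (proj₂ (proj₂ a)))
      ; P-last = trans (fromPath-end P) (sym (proj₂ (proj₂ b)))
      ; P-avoids-v = λ 1≤t t≤ r t′≤ eq →
          proj₁ (proj₂ shortcut) _ (P-inner 1≤t t≤) (π r , fromPath-On⁺ (Q (π r)) (_ , t′≤ , sym eq))
      ; P-avoids-e = λ h r h′ → proj₂ (proj₂ shortcut) _ (subst (_ ∈_) (fromPath-E P) (E⁺ (fromPath P) h))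
                                                        (theta-path⊆edges T (π r) (edge-of r h′))
      }

    contrabalanced-along : Contrabalanced Ω T →
      ∀ r s → r ≢ s → balanced Ω (edgesOf shortcut-theta (along r ∪ along s)) ≡ false
    contrabalanced-along contrabalanced r s r≢s =
      trans (cong (balanced Ω) (trans (edgesOf-∪ shortcut-theta (along r) (along s))
                                      (cong₂ _∪_ (theta-path r) (theta-path s))))
            (contrabalanced (π r) (π s) (π-injective r≢s))
      where
      theta-path : ∀ r → edgesOf shortcut-theta (along r) ≡ pathEdges (Q (π r))
      theta-path r = trans (sym (along-edges shortcut-theta r)) (fromPath-E (Q (π r)))

lemma3p9 : ∀ {n m} (Ω : BiasedGraph n m) (T : Theta (graph Ω)) →
  Contrabalanced Ω T → Σ (Path (graph Ω)) (Shortcut Ω T) →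
  IsMinorOf (UniformIndep 2 4) (FrameIndep Ω)
lemma3p9 Ω T contrabalanced (P , shortcut) =
  u₂₄-minor-of-contrabalanced shortcut-theta (contrabalanced-along contrabalanced)
  where
  open Subdivision Ω
  open FromShortcut T P shortcut
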